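{- Let $r\ge1$ be an integer. Any simple matroid of rank $r$ that is a minor of a matroid in $\mathcal{M}_v(\Phi_{Y_1})$ is isomorphic to a restriction of $X_r$.
   Context: The class $\mathcal{M}_v(\Phi_{Y_1})$ (matroids virtually conforming to the template $\Phi_{Y_1}$) is the class of all matroids isomorphic to the column matroid $M(A)$ of a matrix $A$ over $\mathrm{GF}(2)$ whose rows are indexed by $\{x_1,x_2\}\cup R$ for some finite set $R$, such that every column of $A$ is of one of the following two kinds: (a) its entries in rows $x_1,x_2$ are both $0$ and it has at most two nonzero entries in rows $R$; or (b) its entries in rows $(x_1,x_2)$ are $(1,0)$, $(0,1)$ or $(1,1)$ and it has at most one nonzero entry in rows $R$. The matroid $X_r$ is defined by $X_1=U_{1,1}$ and, for $r\ge2$, $X_r$ is the column matroid of the binary matrix with rows $1,\dots,r$ whose columns (with $e_i$ the $i$-th unit vector) are: $e_i$ for $3\le i\le r$; $e_i+e_j$ for $3\le i<j\le r$; $u$ and $u+e_i$ for each $u\in\{e_1,e_2,e_1+e_2\}$ and $3\le i\le r$. (Equivalently, $X_r$ is the largest simple rank-$r$ matroid in $\mathcal{M}_v(\Phi_{Y_1})$.) -}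

module Defs where

open import Data.Nat using (ℕ; zero; suc; _+_; _≤_; _<_)
open import Data.Bool using (Bool; true; false; _∧_; _xor_; if_then_else_; not)
open import Data.Fin using (Fin; _↑ʳ_; _≟_; _<?_)
open import Data.Fin.Subset using (Subset; _∈_; _∉_; _⊆_; _∪_; ⁅_⁆; ∣_∣; Nonempty)
open import Data.List using (List; []; _∷_; [_]; _++_; map; concatMap; allFin; foldr; length; lookup)
open import Data.Bool.ListAction using (any)
open import Data.Nat.ListAction using (sum)
open import Data.Vec using (tabulate)
open import Data.Product using (Σ; ∃; _×_; _,_)
open import Data.Sum using (_⊎_)
open import Relation.Nullary using (¬_)
open import Relation.Nullary.Decidable using (⌊_⌋)
open import Relation.Binary.PropositionalEquality using (_≡_; _≢_)
open import Function.Bundles using (_⇔_; _⤖_; Bijection)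
open import Function.Definitions using (Injective)

-- Matroids on the finite ground set Fin n, given by their independent sets.

Matroid : ℕ → Set₁
Matroid n = Subset n → Set

record IsMatroid {n : ℕ} (M : Matroid n) : Set where
  field
    empty-indep : M (Data.Fin.Subset.⊥)
    down-closed : ∀ I J → I ⊆ J → M J → M I
    augment     : ∀ I J → M I → M J → ∣ I ∣ < ∣ J ∣ →
                  ∃ λ x → x ∈ J × x ∉ I × M (I ∪ ⁅ x ⁆)

HasRank : {n : ℕ} → Matroid n → ℕ → Set
HasRank M r = (∃ λ I → M I × ∣ I ∣ ≡ r) × (∀ I → M I → ∣ I ∣ ≤ r)

-- Simple: no loops and no parallel pairs, i.e. every set of size ≤ 2 is independent.
Simple : {n : ℕ} → Matroid n → Set
Simple M = ∀ I → ∣ I ∣ ≤ 2 → M I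

IsBasisOf : {n : ℕ} → Matroid n → Subset n → Subset n → Set
IsBasisOf M C B = B ⊆ C × M B × (∀ x → x ∈ C → x ∉ B → ¬ M (B ∪ ⁅ x ⁆))

image : {k n : ℕ} → (Fin k → Fin n) → Subset k → Subset n
image {k} f I = tabulate λ y → any (λ x → Data.Vec.lookup I x ∧ ⌊ f x ≟ y ⌋) (allFin k)

Iso : {k n : ℕ} → Matroid k → Matroid n → Set
Iso {k} {n} N M = Σ (Fin k ⤖ Fin n) λ σ → ∀ I → N I ⇔ M (image (Bijection.to σ) I)

-- N is isomorphic to a minor M / C \ D of M: f identifies the ground set of N with
-- E(M) - C - D (D = everything outside C ∪ image f).  A set I is independent in M / C
-- iff I ∪ B is independent in M for a basis B of M|C.
IsoToMinor : {k n : ℕ} → Matroid k → Matroid n → Set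
IsoToMinor {k} {n} N M =
  Σ (Fin k → Fin n) λ f → Injective _≡_ _≡_ f ×
  Σ (Subset n) λ C → (∀ x → f x ∉ C) ×
  Σ (Subset n) λ B → IsBasisOf M C B ×
  (∀ I → N I ⇔ M (image f I ∪ B))

IsoToRestriction : {k n : ℕ} → Matroid k → Matroid n → Set
IsoToRestriction {k} {n} N M =
  Σ (Fin k → Fin n) λ f → Injective _≡_ _≡_ f × (∀ I → N I ⇔ M (image f I))

-- Binary matrices and their column matroids.
-- A matrix with rows Fin m and columns Fin n over GF(2) = Bool (xor, ∧).

BinMatrix : ℕ → ℕ → Set
BinMatrix m n = Fin m → Fin n → Bool

colSum : {m n : ℕ} → BinMatrix m n → Subset n → Fin m → Bool
colSum {m} {n} A Z i = foldr _xor_ false (map (λ j → Data.Vec.lookup Z j ∧ A i j) (allFin n))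

-- Column matroid: a set of columns is independent iff it is linearly independent
-- over GF(2), i.e. no nonempty subset of it sums to zero.
ColMatroid : {m n : ℕ} → BinMatrix m n → Matroid n
ColMatroid A Y = ∀ Z → Z ⊆ Y → Nonempty Z → ¬ (∀ i → colSum A Z i ≡ false)

-- The template Φ_{Y1}: rows {x1,x2} ∪ R with R = Fin t; row x1 = 0, x2 = 1,
-- the rows of R are 2 ↑ʳ i.

b2n : Bool → ℕ
b2n b = if b then 1 else 0

nnzR : {t n : ℕ} → BinMatrix (2 + t) n → Fin n → ℕ
nnzR {t} A c = sum (map (λ i → b2n (A (2 ↑ʳ i) c)) (allFin t))

x₁ x₂ : {t : ℕ} → Fin (2 + t)
x₁ = Fin.zero
x₂ = Fin.suc Fin.zero

ConformingColumn : {t n : ℕ} → BinMatrix (2 + t) n → Fin n → Set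
ConformingColumn A c =
  (A x₁ c ≡ false × A x₂ c ≡ false × nnzR A c ≤ 2)
  ⊎ (¬ (A x₁ c ≡ false × A x₂ c ≡ false) × nnzR A c ≤ 1)

ConformsΦY1 : {t n : ℕ} → BinMatrix (2 + t) n → Set
ConformsΦY1 {t} {n} A = ∀ c → ConformingColumn A c

InMvΦY1 : {n : ℕ} → Matroid n → Set
InMvΦY1 {n} M = Σ ℕ λ t → Σ ℕ λ n' → Σ (BinMatrix (2 + t) n') λ A →
  ConformsΦY1 A × Iso M (ColMatroid A)

unitVec : {r : ℕ} → Fin r → Fin r → Bool
unitVec i k = ⌊ i ≟ k ⌋

_⊕_ : {r : ℕ} → (Fin r → Bool) → (Fin r → Bool) → Fin r → Bool
(u ⊕ v) k = u k xor v k

ltPairs : (s : ℕ) → List (Fin s × Fin s)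
ltPairs s = concatMap (λ i → concatMap (λ j → if ⌊ i <? j ⌋ then [ (i , j) ] else []) (allFin s)) (allFin s)

-- columns of X_r (rows 1,2 of the paper are Fin indices 0,1; rows 3..r are 2 ↑ʳ i)

XColumns : (r : ℕ) → List (Fin r → Bool)
XColumns zero = []
XColumns (suc zero) = [ (λ _ → true) ]
XColumns (suc (suc s)) =
     map (λ i → e (2 ↑ʳ i)) (allFin s)
  ++ map (λ { (i , j) → e (2 ↑ʳ i) ⊕ e (2 ↑ʳ j) }) (ltPairs s)
  ++ concatMap (λ u → u ∷ map (λ i → u ⊕ e (2 ↑ʳ i)) (allFin s)) us
  where
    e : Fin (suc (suc s)) → Fin (suc (suc s)) → Bool
    e = unitVec
    us : List (Fin (suc (suc s)) → Bool)
    us = e Fin.zero ∷ e (Fin.suc Fin.zero) ∷ (e Fin.zero ⊕ e (Fin.suc Fin.zero)) ∷ []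

XMatrix : (r : ℕ) → BinMatrix r (length (XColumns r))
XMatrix r i c = lookup (XColumns r) c i

X : (r : ℕ) → Matroid (length (XColumns r))
X r = ColMatroid (XMatrix r)

-- A matroid in M_v(Φ_{Y1}) is the column matroid of a binary matrix each of whose columns conforms
-- to the template, i.e. has at most two nonzero "slots", where x₁ and x₂ together form one slot and
-- every row of R is a slot.  A minor N = M / C \ D is obtained by contracting a basis B of C, and
-- contracting an element x amounts to pivoting on a nonzero entry of its column; pivoting on an
-- entry in R whenever there is one keeps every column conforming, so N is again represented by a
-- conforming matrix.  Deleting a row whose unit vector is outside the column space changes neither
-- the matroid nor conformance, and once every unit vector lies in the column space the exchange
-- lemma bounds the number of rows by the rank r.  After padding with zero rows to exactly r rows,
-- the columns of the simple matroid N are distinct nonzero conforming vectors of GF(2)^r, and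
-- these are precisely the columns of X_r.

module Submission where

open import Defs
open import Level using (0ℓ)
open import Function.Bundles using (_⇔_; mk⇔; Equivalence; Bijection)
open import Function.Definitions using (Injective)
import Function.Properties.Equivalence as ⇔
open import Data.Empty using (⊥; ⊥-elim)
open import Data.Product using (Σ; ∃; _×_; _,_; proj₁; proj₂)
open import Data.Sum using (_⊎_; inj₁; inj₂)
open import Data.Nat using (ℕ; zero; suc; _+_; _≤_; z≤n; s≤s; _≤′_; ≤′-refl; ≤′-step)
import Data.Nat.Properties as ℕₚ
open import Data.Bool using (Bool; true; false; _∧_; _∨_; _xor_; not; if_then_else_; T)
open import Data.Bool.Properties
  using (xor-comm; xor-same; xor-identityʳ; ∧-zeroʳ; ∧-identityʳ; ∧-assoc; ∧-comm;
         ∧-distribʳ-xor; ∧-distribˡ-xor; ∨-zeroʳ; ∨-identityʳ)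
import Data.Bool.Properties as Boolₚ
import Data.Bool.ListAction as BoolList
open import Data.Fin using (Fin; _≟_; _↑ʳ_; _<?_; punchIn; punchOut)
import Data.Fin as F
import Data.Fin.Properties as Finₚ
import Data.Fin.Subset as S
import Data.Fin.Subset.Properties as Sₚ
open import Data.Vec using ([]; _∷_; here; there)
import Data.Vec as Vec
import Data.Vec.Properties as Vecₚ
open import Data.Vec.Functional using (Vector; removeAt; insertAt)
import Data.Vec.Functional as VF
import Data.Vec.Functional.Properties as VFₚ
import Data.List as List
open import Data.List.Relation.Unary.Any using (Any; here; there)
import Data.List.Relation.Unary.Any as Any
open import Data.List.Relation.Unary.Any.Properties
  using (any⁺; any⁻; tabulate⁺; tabulate⁻; map⁺; ++⁺ˡ; ++⁺ʳ; concatMap⁺; lookup-index)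
open import Relation.Nullary using (¬_; Dec; yes; no)
open import Relation.Nullary.Decidable using (⌊_⌋; map′; _×-dec_; ¬?; decidable-stable)
open import Relation.Binary.PropositionalEquality
open import Relation.Binary.Definitions using (tri<; tri≈; tri>)
import Relation.Binary.Reasoning.Setoid
open import Algebra.Bundles using (CommutativeRing)
open import Algebra.Properties.CommutativeSemigroup
  (CommutativeRing.+-commutativeSemigroup Boolₚ.xor-∧-commutativeRing)
  using () renaming (interchange to xor-interchange)

module ⇔-Reasoning = Relation.Binary.Reasoning.Setoid (⇔.⇔-setoid 0ℓ)

true≢false : true ≢ false
true≢false ()

≢true⇒≡false : ∀ {b} → ¬ (b ≡ true) → b ≡ false
≢true⇒≡false {true} ne = ⊥-elim (ne refl)
≢true⇒≡false {false} _ = refl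

xor≡false⇒≡ : ∀ a b → a xor b ≡ false → a ≡ b
xor≡false⇒≡ true true _ = refl
xor≡false⇒≡ false false _ = refl

∧≡true⇒× : ∀ {a b} → a ∧ b ≡ true → a ≡ true × b ≡ true
∧≡true⇒× {true} {true} _ = refl , refl

∨≡true⇒⊎ : ∀ {a b} → a ∨ b ≡ true → a ≡ true ⊎ b ≡ true
∨≡true⇒⊎ {true} _ = inj₁ refl
∨≡true⇒⊎ {false} e = inj₂ e

∨≡false⇒× : ∀ {a b} → a ∨ b ≡ false → a ≡ false × b ≡ false
∨≡false⇒× {false} {false} _ = refl , refl

xor≡true⇒⊎ : ∀ {a b} → a xor b ≡ true → a ≡ true ⊎ b ≡ true
xor≡true⇒⊎ {true} _ = inj₁ refl
xor≡true⇒⊎ {false} e = inj₂ e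

xor≡true⇒∨≡true : ∀ {a b} → a xor b ≡ true → a ∨ b ≡ true
xor≡true⇒∨≡true {true} _ = refl
xor≡true⇒∨≡true {false} e = e

xor-∨-xor≡true⇒ : ∀ a b c d → (a xor c) ∨ (b xor d) ≡ true → a ∨ b ≡ true ⊎ c ∨ d ≡ true
xor-∨-xor≡true⇒ true b c d _ = inj₁ refl
xor-∨-xor≡true⇒ false true c d _ = inj₁ refl
xor-∨-xor≡true⇒ false false c d e = inj₂ e

unitVec-same : {n : ℕ} (x : Fin n) → unitVec x x ≡ true
unitVec-same x with x ≟ x
... | yes _ = refl
... | no x≢x = ⊥-elim (x≢x refl)

unitVec-other : {n : ℕ} {x j : Fin n} → x ≢ j → unitVec x j ≡ false
unitVec-other {x = x} {j} x≢j with x ≟ j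
... | yes x≡j = ⊥-elim (x≢j x≡j)
... | no _ = refl

unitVec-true : {n : ℕ} {x j : Fin n} → unitVec x j ≡ true → x ≡ j
unitVec-true {x = x} {j} e with x ≟ j
... | yes x≡j = x≡j

∈⇒≡true : {n : ℕ} {x : Fin n} {Y : S.Subset n} → x S.∈ Y → Vec.lookup Y x ≡ true
∈⇒≡true = Vecₚ.[]=⇒lookup

≡true⇒∈ : {n : ℕ} {x : Fin n} {Y : S.Subset n} → Vec.lookup Y x ≡ true → x S.∈ Y
≡true⇒∈ {x = x} {Y} = Vecₚ.lookup⇒[]= x Y

lookup-⁅⁆ : {n : ℕ} (x j : Fin n) → Vec.lookup S.⁅ x ⁆ j ≡ unitVec x j
lookup-⁅⁆ x j with x ≟ j
... | yes refl = ∈⇒≡true (Sₚ.x∈⁅x⁆ x)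
... | no x≢j = ≢true⇒≡false (λ e → Sₚ.x≢y⇒x∉⁅y⁆ (λ j≡x → x≢j (sym j≡x)) (≡true⇒∈ e))

lookup-∪-⁅⁆ : {n : ℕ} (p : S.Subset n) (x j : Fin n) →
  Vec.lookup (p S.∪ S.⁅ x ⁆) j ≡ Vec.lookup p j ∨ unitVec x j
lookup-∪-⁅⁆ p x j = trans (Vecₚ.lookup-zipWith _∨_ j p S.⁅ x ⁆) (cong (Vec.lookup p j ∨_) (lookup-⁅⁆ x j))

∣p∪⁅x⁆∣≡suc∣p∣ : {n : ℕ} (p : S.Subset n) (x : Fin n) → x S.∉ p → S.∣ p S.∪ S.⁅ x ⁆ ∣ ≡ suc S.∣ p ∣
∣p∪⁅x⁆∣≡suc∣p∣ (true ∷ p) F.zero x∉p = ⊥-elim (x∉p here)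
∣p∪⁅x⁆∣≡suc∣p∣ (false ∷ p) F.zero _ = cong (λ q → suc S.∣ q ∣) (Sₚ.∪-identityʳ p)
∣p∪⁅x⁆∣≡suc∣p∣ (true ∷ p) (F.suc x) x∉p = cong suc (∣p∪⁅x⁆∣≡suc∣p∣ p x (λ x∈p → x∉p (there x∈p)))
∣p∪⁅x⁆∣≡suc∣p∣ (false ∷ p) (F.suc x) x∉p = ∣p∪⁅x⁆∣≡suc∣p∣ p x (λ x∈p → x∉p (there x∈p))

∣⁅x⁆∪⁅y⁆∣≡2 : {n : ℕ} {x y : Fin n} → x ≢ y → S.∣ S.⁅ x ⁆ S.∪ S.⁅ y ⁆ ∣ ≡ 2
∣⁅x⁆∪⁅y⁆∣≡2 {x = x} {y} x≢y =
  trans (∣p∪⁅x⁆∣≡suc∣p∣ S.⁅ x ⁆ y (λ y∈x → x≢y (sym (Sₚ.x∈⁅y⁆⇒x≡y x y∈x)))) (cong suc (Sₚ.∣⁅x⁆∣≡1 x))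

∣p∣≡suc∣p-x∣ : {n : ℕ} (p : S.Subset n) {x : Fin n} → x S.∈ p → S.∣ p ∣ ≡ suc S.∣ p S.- x ∣
∣p∣≡suc∣p-x∣ (true ∷ p) here = cong (λ q → suc S.∣ false ∷ q ∣) (sym (Sₚ.p─⊥≡p p))
∣p∣≡suc∣p-x∣ (true ∷ p) (there x∈p) = cong suc (∣p∣≡suc∣p-x∣ p x∈p)
∣p∣≡suc∣p-x∣ (false ∷ p) (there x∈p) = ∣p∣≡suc∣p-x∣ p x∈p

x∉p-x : {n : ℕ} (p : S.Subset n) (x : Fin n) → x S.∉ p S.- x
x∉p-x (b ∷ p) F.zero ()
x∉p-x (b ∷ p) (F.suc x) (there x∈p-x) = x∉p-x p x x∈p-x

-- A Vector Bool k is used both as a vector over GF(2) and as (the characteristic function of) a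
-- subset of Fin k; in particular unitVec x is both the unit vector e_x and the singleton {x}.
Family : ℕ → ℕ → Set
Family k m = Fin k → Vector Bool m

_·_ : {m : ℕ} → Bool → Vector Bool m → Vector Bool m
(b · v) i = b ∧ v i

xorSum : {n : ℕ} → Vector Bool n → Bool
xorSum = VF.foldr _xor_ false

linComb : {k m : ℕ} → Vector Bool k → Family k m → Vector Bool m
linComb Z w i = xorSum (λ j → Z j ∧ w j i)

IsZero : {m : ℕ} → Vector Bool m → Set
IsZero v = ∀ i → v i ≡ false

_⊑_ : {n : ℕ} → Vector Bool n → Vector Bool n → Set
Z ⊑ I = ∀ j → Z j ≡ true → I j ≡ true

NonEmpty : {n : ℕ} → Vector Bool n → Set
NonEmpty Z = ∃ λ j → Z j ≡ true

LinIndep : {k m : ℕ} → Family k m → Vector Bool k → Set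
LinIndep w I = ∀ Z → Z ⊑ I → NonEmpty Z → ¬ IsZero (linComb Z w)

xorSum-cong : {n : ℕ} {f g : Vector Bool n} → f ≗ g → xorSum f ≡ xorSum g
xorSum-cong {zero} _ = refl
xorSum-cong {suc n} f≗g = cong₂ _xor_ (f≗g F.zero) (xorSum-cong (λ i → f≗g (F.suc i)))

xorSum-zero : {n : ℕ} (f : Vector Bool n) → IsZero f → xorSum f ≡ false
xorSum-zero {zero} f _ = refl
xorSum-zero {suc n} f f≡0 rewrite f≡0 F.zero = xorSum-zero (VF.tail f) (λ i → f≡0 (F.suc i))

xorSum-xor : {n : ℕ} (f g : Vector Bool n) → xorSum (λ i → f i xor g i) ≡ xorSum f xor xorSum g
xorSum-xor {zero} f g = refl
xorSum-xor {suc n} f g =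
  trans (cong ((f F.zero xor g F.zero) xor_) (xorSum-xor (VF.tail f) (VF.tail g)))
        (xor-interchange (f F.zero) (g F.zero) (xorSum (VF.tail f)) (xorSum (VF.tail g)))

xorSum-scale : {n : ℕ} (b : Bool) (f : Vector Bool n) → xorSum (λ i → b ∧ f i) ≡ b ∧ xorSum f
xorSum-scale true f = refl
xorSum-scale {n} false f = xorSum-zero {n} (λ _ → false) (λ _ → refl)

xorSum-single : {n : ℕ} (f : Vector Bool n) (j : Fin n) → (∀ i → i ≢ j → f i ≡ false) → xorSum f ≡ f j
xorSum-single f F.zero rest
  rewrite xorSum-zero (VF.tail f) (λ i → rest (F.suc i) (λ ())) = xor-identityʳ (f F.zero)
xorSum-single f (F.suc j) rest
  rewrite rest F.zero (λ ()) =
  xorSum-single (VF.tail f) j (λ i i≢j → rest (F.suc i) (λ e → i≢j (Finₚ.suc-injective e)))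

linComb-cong : {k m : ℕ} {Z Z′ : Vector Bool k} (w : Family k m) → Z ≗ Z′ → linComb Z w ≗ linComb Z′ w
linComb-cong w Z≗Z′ i = xorSum-cong (λ j → cong (_∧ w j i) (Z≗Z′ j))

linComb-congʳ : {k m : ℕ} (Z : Vector Bool k) {w w′ : Family k m} → (∀ j → w j ≗ w′ j) →
  linComb Z w ≗ linComb Z w′
linComb-congʳ Z w≗w′ i = xorSum-cong (λ j → cong (Z j ∧_) (w≗w′ j i))

linComb-xor : {k m : ℕ} (Z₁ Z₂ : Vector Bool k) (w : Family k m) →
  linComb (Z₁ ⊕ Z₂) w ≗ linComb Z₁ w ⊕ linComb Z₂ w
linComb-xor Z₁ Z₂ w i =
  trans (xorSum-cong (λ j → ∧-distribʳ-xor (w j i) (Z₁ j) (Z₂ j)))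
        (xorSum-xor (λ j → Z₁ j ∧ w j i) (λ j → Z₂ j ∧ w j i))

linComb-scale : {k m : ℕ} (b : Bool) (Z : Vector Bool k) (w : Family k m) →
  linComb (b · Z) w ≗ b · linComb Z w
linComb-scale b Z w i =
  trans (xorSum-cong (λ j → ∧-assoc b (Z j) (w j i))) (xorSum-scale b (λ j → Z j ∧ w j i))

linComb-unitVec : {k m : ℕ} (x : Fin k) (w : Family k m) → linComb (unitVec x) w ≗ w x
linComb-unitVec x w i =
  trans (xorSum-single _ x (λ j j≢x → cong (_∧ w j i) (unitVec-other (λ x≡j → j≢x (sym x≡j)))))
        (cong (_∧ w x i) (unitVec-same x))

linComb-zero : {k m : ℕ} (Z : Vector Bool k) (w : Family k m) → IsZero Z → IsZero (linComb Z w)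
linComb-zero Z w Z≡0 i = xorSum-zero _ (λ j → cong (_∧ w j i) (Z≡0 j))

delete : {n : ℕ} → Fin n → Vector Bool n → Vector Bool n
delete x Z j = Z j ∧ not (unitVec x j)

delete-⊕ : {n : ℕ} (x : Fin n) (Z : Vector Bool n) → Z ≗ delete x Z ⊕ (Z x · unitVec x)
delete-⊕ x Z j with x ≟ j
... | yes refl = split (Z x)
  where
  split : ∀ b → b ≡ (b ∧ false) xor (b ∧ true)
  split true = refl
  split false = refl
... | no _ rewrite ∧-identityʳ (Z j) | ∧-zeroʳ (Z x) = sym (xor-identityʳ (Z j))

linComb-delete : {k m : ℕ} (x : Fin k) (Z : Vector Bool k) (w : Family k m) →
  linComb Z w ≗ linComb (delete x Z) w ⊕ (Z x · w x)
linComb-delete x Z w i = begin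
  linComb Z w i                                   ≡⟨ linComb-cong w (delete-⊕ x Z) i ⟩
  linComb (delete x Z ⊕ (Z x · unitVec x)) w i    ≡⟨ linComb-xor (delete x Z) (Z x · unitVec x) w i ⟩
  a xor linComb (Z x · unitVec x) w i             ≡⟨ cong (a xor_) (linComb-scale (Z x) (unitVec x) w i) ⟩
  a xor (Z x ∧ linComb (unitVec x) w i)           ≡⟨ cong (λ b → a xor (Z x ∧ b)) (linComb-unitVec x w i) ⟩
  a xor (Z x ∧ w x i)                             ∎
  where
  open ≡-Reasoning
  a : Bool
  a = linComb (delete x Z) w i

linComb-delete-zero : {k m : ℕ} (x : Fin k) (Z : Vector Bool k) (w : Family k m) → Z x ≡ true →
  IsZero (linComb Z w) → linComb (delete x Z) w ≗ w x
linComb-delete-zero x Z w Zx Zw≡0 i = xor≡false⇒≡ _ _ (begin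
  linComb (delete x Z) w i xor (true ∧ w x i)  ≡⟨ cong (λ b → linComb (delete x Z) w i xor (b ∧ w x i)) Zx ⟨
  linComb (delete x Z) w i xor (Z x ∧ w x i)   ≡⟨ linComb-delete x Z w i ⟨
  linComb Z w i                                ≡⟨ Zw≡0 i ⟩
  false                                        ∎)
  where open ≡-Reasoning

_∪_ : {n : ℕ} → Vector Bool n → Vector Bool n → Vector Bool n
(Y ∪ C) j = Y j ∨ C j

insert : {n : ℕ} → Fin n → Vector Bool n → Vector Bool n
insert x I j = I j ∨ unitVec x j

delete-true : {n : ℕ} {x j : Fin n} (Z : Vector Bool n) → delete x Z j ≡ true → Z j ≡ true × x ≢ j
delete-true {x = x} {j} Z e with ∧≡true⇒× {Z j} e
... | Zj , notx = Zj , λ { refl → true≢false (trans (sym notx) (cong not (unitVec-same x))) }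

delete-other : {n : ℕ} {x j : Fin n} (Z : Vector Bool n) → x ≢ j → delete x Z j ≡ Z j
delete-other Z x≢j rewrite unitVec-other x≢j = ∧-identityʳ _

⊑-insert-other : {n : ℕ} {I Z : Vector Bool n} {x : Fin n} → Z ⊑ insert x I →
  ∀ j → Z j ≡ true → x ≢ j → I j ≡ true
⊑-insert-other {I = I} Z⊑I+x j Zj x≢j =
  trans (sym (trans (cong (I j ∨_) (unitVec-other x≢j)) (∨-identityʳ (I j)))) (Z⊑I+x j Zj)

LinIndep-⊑ : {k m : ℕ} (w : Family k m) {I I′ : Vector Bool k} → I′ ⊑ I → LinIndep w I → LinIndep w I′
LinIndep-⊑ w I′⊑I indep Z Z⊑I′ = indep Z (λ j Zj → I′⊑I j (Z⊑I′ j Zj))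

LinIndep-cong : {k m : ℕ} (w : Family k m) {I I′ : Vector Bool k} → I ≗ I′ → LinIndep w I ⇔ LinIndep w I′
LinIndep-cong w I≗I′ =
  mk⇔ (LinIndep-⊑ w (λ j → trans (I≗I′ j))) (LinIndep-⊑ w (λ j → trans (sym (I≗I′ j))))

LinIndep-congʳ : {k m : ℕ} {w w′ : Family k m} (I : Vector Bool k) → (∀ j → w j ≗ w′ j) →
  LinIndep w I ⇔ LinIndep w′ I
LinIndep-congʳ I w≗w′ =
  mk⇔ (λ indep Z Z⊑I ne Z≡0 → indep Z Z⊑I ne (λ i → trans (linComb-congʳ Z w≗w′ i) (Z≡0 i)))
      (λ indep Z Z⊑I ne Z≡0 → indep Z Z⊑I ne (λ i → trans (sym (linComb-congʳ Z w≗w′ i)) (Z≡0 i)))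

LinIndep-unitVec⇒nonzero : {k m : ℕ} (w : Family k m) (x : Fin k) → LinIndep w (unitVec x) → NonEmpty (w x)
LinIndep-unitVec⇒nonzero w x indep with Finₚ.any? (λ i → w x i Boolₚ.≟ true)
... | yes nonzero = nonzero
... | no allZero = ⊥-elim (indep (unitVec x) (λ _ e → e) (x , unitVec-same x)
                          (λ i → trans (linComb-unitVec x w i) (≢true⇒≡false (λ e → allZero (i , e)))))

columns : {m n : ℕ} → BinMatrix m n → Family n m
columns A j i = A i j

foldr-map-tabulate : {A B C : Set} (f : B → C → C) (e : C) (h : A → B) {n : ℕ} (g : Fin n → A) →
  List.foldr f e (List.map h (List.tabulate g)) ≡ VF.foldr f e (λ i → h (g i))
foldr-map-tabulate f e h {zero} g = refl
foldr-map-tabulate f e h {suc n} g = cong (f (h (g F.zero))) (foldr-map-tabulate f e h (λ i → g (F.suc i)))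

colSum≡linComb : {m n : ℕ} (A : BinMatrix m n) (Z : S.Subset n) →
  colSum A Z ≗ linComb (Vec.lookup Z) (columns A)
colSum≡linComb A Z i = foldr-map-tabulate _xor_ false (λ j → Vec.lookup Z j ∧ A i j) (λ j → j)

ColMatroid⇔LinIndep : {m n : ℕ} (A : BinMatrix m n) (Y : S.Subset n) →
  ColMatroid A Y ⇔ LinIndep (columns A) (Vec.lookup Y)
ColMatroid⇔LinIndep A Y = mk⇔ to from
  where
  to : ColMatroid A Y → LinIndep (columns A) (Vec.lookup Y)
  to indep Z Z⊑Y (j , Zj) Z≡0 =
    indep (Vec.tabulate Z)
          (λ {x} x∈Z → ≡true⇒∈ (Z⊑Y x (trans (sym (Vecₚ.lookup∘tabulate Z x)) (∈⇒≡true x∈Z))))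
          (j , ≡true⇒∈ (trans (Vecₚ.lookup∘tabulate Z j) Zj))
          (λ i → trans (colSum≡linComb A (Vec.tabulate Z) i)
                       (trans (linComb-cong (columns A) (Vecₚ.lookup∘tabulate Z) i) (Z≡0 i)))
  from : LinIndep (columns A) (Vec.lookup Y) → ColMatroid A Y
  from indep Z Z⊆Y (j , j∈Z) Z≡0 =
    indep (Vec.lookup Z) (λ x Zx → ∈⇒≡true (Z⊆Y (≡true⇒∈ Zx))) (j , ∈⇒≡true j∈Z)
          (λ i → trans (sym (colSum≡linComb A Z i)) (Z≡0 i))

-- Spans and the exchange lemma

InSpan : {k m : ℕ} → Family k m → Vector Bool m → Set
InSpan w v = ∃ λ Z → linComb Z w ≗ v

InSpan? : {k m : ℕ} (w : Family k m) (v : Vector Bool m) → Dec (InSpan w v)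
InSpan? w v =
  map′ (λ (Z , Zw≗v) → Vec.lookup Z , Zw≗v)
       (λ (Z , Zw≗v) → Vec.tabulate Z , λ i → trans (linComb-cong w (Vecₚ.lookup∘tabulate Z) i) (Zw≗v i))
       (Sₚ.anySubset? (λ Z → Finₚ.all? (λ i → linComb (Vec.lookup Z) w i Boolₚ.≟ v i)))

InSpan-linComb : {k k′ m : ℕ} (u : Family k m) (w : Family k′ m) → (∀ x → InSpan u (w x)) →
  ∀ Z → InSpan u (linComb Z w)
InSpan-linComb {k′ = zero} u w _ Z = (λ _ → false) , linComb-zero (λ _ → false) u (λ _ → refl)
InSpan-linComb {k′ = suc k′} u w span Z
  with span F.zero | InSpan-linComb u (VF.tail w) (λ x → span (F.suc x)) (VF.tail Z)
... | Y₀ , Y₀u≗w₀ | Y , Yu≗rest = (z · Y₀) ⊕ Y , λ i → begin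
  linComb ((z · Y₀) ⊕ Y) u i                 ≡⟨ linComb-xor (z · Y₀) Y u i ⟩
  linComb (z · Y₀) u i xor linComb Y u i     ≡⟨ cong₂ _xor_ (linComb-scale z Y₀ u i) (Yu≗rest i) ⟩
  (z ∧ linComb Y₀ u i) xor _                 ≡⟨ cong (λ b → (z ∧ b) xor _) (Y₀u≗w₀ i) ⟩
  linComb Z w i                              ∎
  where
  open ≡-Reasoning
  z : Bool
  z = Z F.zero

restrict : {k m : ℕ} → Vector Bool k → Family k m → Family k m
restrict S w j = S j · w j

linComb-restrict : {k m : ℕ} {S Z : Vector Bool k} (w : Family k m) → Z ⊑ S →
  linComb Z (restrict S w) ≗ linComb Z w
linComb-restrict {S = S} {Z} w Z⊑S i = xorSum-cong coefficient
  where
  coefficient : ∀ j → Z j ∧ (S j ∧ w j i) ≡ Z j ∧ w j i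
  coefficient j with Z j in Zj
  ... | false = refl
  ... | true rewrite Z⊑S j Zj = refl

linComb-shear : {k m : ℕ} (Y : Vector Bool k) (w : Family k m) (a : Vector Bool k) (v : Vector Bool m) →
  linComb Y (λ j → w j ⊕ (a j · v)) ≗ linComb Y w ⊕ (xorSum (λ j → Y j ∧ a j) · v)
linComb-shear Y w a v i = begin
  xorSum (λ j → Y j ∧ (w j i xor (a j ∧ v i)))          ≡⟨ xorSum-cong distrib ⟩
  xorSum (λ j → (Y j ∧ w j i) xor (v i ∧ Ya j))         ≡⟨ xorSum-xor (λ j → Y j ∧ w j i) (λ j → v i ∧ Ya j) ⟩
  linComb Y w i xor xorSum (λ j → v i ∧ Ya j)           ≡⟨ cong (linComb Y w i xor_) (xorSum-scale (v i) Ya) ⟩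
  linComb Y w i xor (v i ∧ xorSum Ya)                   ≡⟨ cong (linComb Y w i xor_) (∧-comm (v i) _) ⟩
  linComb Y w i xor (xorSum Ya ∧ v i)                   ∎
  where
  open ≡-Reasoning
  Ya : Vector Bool _
  Ya j = Y j ∧ a j
  distrib : ∀ j → Y j ∧ (w j i xor (a j ∧ v i)) ≡ (Y j ∧ w j i) xor (v i ∧ (Y j ∧ a j))
  distrib j = trans (∧-distribˡ-xor (Y j) (w j i) (a j ∧ v i))
                    (cong ((Y j ∧ w j i) xor_) (trans (sym (∧-assoc (Y j) (a j) (v i))) (∧-comm _ (v i))))

LinIndep-shear : {m m′ : ℕ} (u : Family m′ m) (T : S.Subset m′) {j : Fin m′} → j S.∈ T →
  LinIndep u (Vec.lookup T) → (c : Vector Bool m′) → LinIndep (λ q → u q ⊕ (c q · u j)) (Vec.lookup (T S.- j))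
LinIndep-shear u T {j} j∈T indep c Y Y⊑T-j (q₀ , Yq₀) Yu′≡0 = indep Y′ Y′⊑T (q₀ , Y′q₀) Y′u≡0
  where
  p : Bool
  p = xorSum (λ q → Y q ∧ c q)
  Y′ : Vector Bool _
  Y′ = Y ⊕ (p · unitVec j)
  Y⊑T : ∀ q → Y q ≡ true → Vec.lookup T q ≡ true
  Y⊑T q Yq = ∈⇒≡true (Sₚ.p─q⊆p T S.⁅ j ⁆ (≡true⇒∈ (Y⊑T-j q Yq)))
  j≢q₀ : j ≢ q₀
  j≢q₀ refl = x∉p-x T j (≡true⇒∈ (Y⊑T-j j Yq₀))
  Y′q₀ : Y′ q₀ ≡ true
  Y′q₀ rewrite unitVec-other j≢q₀ | ∧-zeroʳ p | xor-identityʳ (Y q₀) = Yq₀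
  Y′⊑T : Y′ ⊑ Vec.lookup T
  Y′⊑T q Y′q with j ≟ q
  ... | yes refl = ∈⇒≡true j∈T
  ... | no _ rewrite ∧-zeroʳ p | xor-identityʳ (Y q) = Y⊑T q Y′q
  Y′u≡0 : IsZero (linComb Y′ u)
  Y′u≡0 i = begin
    linComb Y′ u i                              ≡⟨ linComb-xor Y (p · unitVec j) u i ⟩
    a xor linComb (p · unitVec j) u i           ≡⟨ cong (a xor_) (linComb-scale p (unitVec j) u i) ⟩
    a xor (p ∧ linComb (unitVec j) u i)         ≡⟨ cong (λ b → a xor (p ∧ b)) (linComb-unitVec j u i) ⟩
    a xor (p ∧ u j i)                           ≡⟨ linComb-shear Y u c (u j) i ⟨
    linComb Y (λ q → u q ⊕ (c q · u j)) i       ≡⟨ Yu′≡0 i ⟩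
    false                                       ∎
    where
    open ≡-Reasoning
    a : Bool
    a = linComb Y u i

linComb-eliminate : {k m : ℕ} (W : Family (suc k) m) (Zq Zj : Vector Bool (suc k)) → Zj F.zero ≡ true →
  linComb (VF.tail Zq ⊕ (Zq F.zero · VF.tail Zj)) (VF.tail W) ≗ linComb Zq W ⊕ (Zq F.zero · linComb Zj W)
linComb-eliminate W Zq Zj Zj₀ i rewrite Zj₀ = begin
  linComb (Zq′ ⊕ (z · Zj′)) W′ i                           ≡⟨ linComb-xor Zq′ (z · Zj′) W′ i ⟩
  a xor linComb (z · Zj′) W′ i                             ≡⟨ cong (a xor_) (linComb-scale z Zj′ W′ i) ⟩
  a xor (z ∧ b)                                            ≡⟨ cancel z (W F.zero i) ⟩
  ((z ∧ W F.zero i) xor a) xor (z ∧ (W F.zero i xor b))    ∎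
  where
  open ≡-Reasoning
  Zq′ Zj′ : Vector Bool _
  Zq′ = VF.tail Zq
  Zj′ = VF.tail Zj
  W′ : Family _ _
  W′ = VF.tail W
  z a b : Bool
  z = Zq F.zero
  a = linComb Zq′ W′ i
  b = linComb Zj′ W′ i
  cancel : ∀ z x → a xor (z ∧ b) ≡ ((z ∧ x) xor a) xor (z ∧ (x xor b))
  cancel false x = refl
  cancel true false = refl
  cancel true true = sym (Boolₚ.xor-annihilates-not a b)

exchange-lemma : {k m m′ : ℕ} (w : Family k m) (S : S.Subset k) (u : Family m′ m) (T : S.Subset m′) →
  LinIndep u (Vec.lookup T) → (Z : Fin m′ → Vector Bool k) →
  (∀ q → q S.∈ T → linComb (Z q) (restrict (Vec.lookup S) w) ≗ u q) → S.∣ T ∣ ≤ S.∣ S ∣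
exchange-lemma {zero} {m′ = m′} w [] u T indep Z span =
  ℕₚ.≤-reflexive (trans (cong S.∣_∣ (Sₚ.Empty-unique noMember)) (Sₚ.∣⊥∣≡0 m′))
  where
  noMember : S.Empty T
  noMember (q , q∈T) =
    indep (unitVec q) (λ j e → subst (λ j → Vec.lookup T j ≡ true) (unitVec-true e) (∈⇒≡true q∈T))
          (q , unitVec-same q) (λ i → trans (linComb-unitVec q u i) (sym (span q q∈T i)))
exchange-lemma {suc k} w (b ∷ S) u T indep Z span
  with Finₚ.any? (λ q → (q Sₚ.∈? T) ×-dec (Z q F.zero ∧ b Boolₚ.≟ true))
... | no unused =
  ℕₚ.≤-trans (exchange-lemma (VF.tail w) S u T indep (λ q → VF.tail (Z q)) span′) (Sₚ.∣p∣≤∣x∷p∣ b S)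
  where
  span′ : ∀ q → q S.∈ T → linComb (VF.tail (Z q)) (restrict (Vec.lookup S) (VF.tail w)) ≗ u q
  span′ q q∈T i = trans (cong (_xor _) (sym headTerm)) (span q q∈T i)
    where
    headTerm : Z q F.zero ∧ (b ∧ w F.zero i) ≡ false
    headTerm = trans (sym (∧-assoc (Z q F.zero) b (w F.zero i)))
                     (cong (_∧ w F.zero i) (≢true⇒≡false (λ used → unused (q , q∈T , used))))
... | yes (j , j∈T , used) with ∧≡true⇒× {Z j F.zero} used
...   | Zj₀ , refl =
  subst (_≤ suc S.∣ S ∣) (sym (∣p∣≡suc∣p-x∣ T j∈T))
        (s≤s (exchange-lemma (VF.tail w) S u′ (T S.- j) indep′ Z′ span′))
  where
  u′ : Family _ _
  u′ q = u q ⊕ (Z q F.zero · u j)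
  Z′ : Fin _ → Vector Bool k
  Z′ q = VF.tail (Z q) ⊕ (Z q F.zero · VF.tail (Z j))
  indep′ : LinIndep u′ (Vec.lookup (T S.- j))
  indep′ = LinIndep-shear u T j∈T indep (λ q → Z q F.zero)
  span′ : ∀ q → q S.∈ T S.- j → linComb (Z′ q) (restrict (Vec.lookup S) (VF.tail w)) ≗ u′ q
  span′ q q∈T-j i =
    trans (linComb-eliminate (restrict (Vec.lookup (true ∷ S)) w) (Z q) (Z j) Zj₀ i)
          (cong₂ (λ x y → x xor (Z q F.zero ∧ y)) (span q (Sₚ.p─q⊆p T S.⁅ j ⁆ q∈T-j) i) (span j j∈T i))

unitVec-independent : {m : ℕ} (I : Vector Bool m) → LinIndep unitVec I
unitVec-independent I Z _ (q , Zq) Z≡0 = true≢false (trans (sym Zq) (trans (sym coordinate) (Z≡0 q)))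
  where
  coordinate : linComb Z unitVec q ≡ Z q
  coordinate = trans (xorSum-single (λ j → Z j ∧ unitVec j q) q offDiagonal)
                     (trans (cong (Z q ∧_) (unitVec-same q)) (∧-identityʳ (Z q)))
    where
    offDiagonal : ∀ j → j ≢ q → Z j ∧ unitVec j q ≡ false
    offDiagonal j j≢q = trans (cong (Z j ∧_) (unitVec-other j≢q)) (∧-zeroʳ (Z j))

dimension-bound : {k m : ℕ} (w : Family k m) (S : S.Subset k) →
  (∀ q → InSpan (restrict (Vec.lookup S) w) (unitVec q)) → m ≤ S.∣ S ∣
dimension-bound {m = m} w S span =
  subst (_≤ S.∣ S ∣) (Sₚ.∣⊤∣≡n m)
        (exchange-lemma w S unitVec S.⊤ (unitVec-independent _)
                        (λ q → proj₁ (span q)) (λ q _ → proj₂ (span q)))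

LinIndep-extend : {k m : ℕ} (w : Family k m) (I : Vector Bool k) (x : Fin k) →
  ¬ InSpan (restrict I w) (w x) → LinIndep w I → LinIndep w (insert x I)
LinIndep-extend w I x notInSpan indep Z Z⊑I+x nonempty Zw≡0 with Z x in Zx
... | false = indep Z Z⊑I nonempty Zw≡0
  where
  Z⊑I : Z ⊑ I
  Z⊑I j Zj = ⊑-insert-other {I = I} Z⊑I+x j Zj (λ { refl → true≢false (trans (sym Zj) Zx) })
... | true =
  notInSpan (delete x Z , λ i → trans (linComb-restrict w deleted⊑I i) (linComb-delete-zero x Z w Zx Zw≡0 i))
  where
  deleted⊑I : delete x Z ⊑ I
  deleted⊑I j e = ⊑-insert-other {I = I} Z⊑I+x j (proj₁ (delete-true Z e)) (proj₂ (delete-true Z e))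

maximal-independent-spans : {k m : ℕ} (w : Family k m) (B : S.Subset k) → LinIndep w (Vec.lookup B) →
  (∀ I → LinIndep w (Vec.lookup I) → S.∣ I ∣ ≤ S.∣ B ∣) → ∀ x → InSpan (restrict (Vec.lookup B) w) (w x)
maximal-independent-spans w B indep maximal x with InSpan? (restrict (Vec.lookup B) w) (w x)
... | yes inSpan = inSpan
... | no notInSpan =
  ⊥-elim (ℕₚ.<-irrefl refl (subst (_≤ S.∣ B ∣) (∣p∪⁅x⁆∣≡suc∣p∣ B x x∉B) (maximal (B S.∪ S.⁅ x ⁆) extended)))
  where
  x∉B : x S.∉ B
  x∉B x∈B = notInSpan (unitVec x , λ i →
    trans (linComb-unitVec x (restrict (Vec.lookup B) w) i) (cong (_∧ w x i) (∈⇒≡true x∈B)))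
  extended : LinIndep w (Vec.lookup (B S.∪ S.⁅ x ⁆))
  extended = Equivalence.from (LinIndep-cong w (lookup-∪-⁅⁆ B x))
                              (LinIndep-extend w (Vec.lookup B) x notInSpan indep)

-- Pivoting and deleting rows

pivot : {m : ℕ} → Vector Bool m → Fin m → Vector Bool m → Vector Bool m
pivot c q v = v ⊕ (v q · c)

linComb-pivot : {k m : ℕ} (c : Vector Bool m) (q : Fin m) (Z : Vector Bool k) (w : Family k m) →
  linComb Z (λ j → pivot c q (w j)) ≗ pivot c q (linComb Z w)
linComb-pivot c q Z w = linComb-shear Z w (λ j → w j q) c

-- Pivoting on the entry q of c = w x is a projection whose kernel is spanned by c, so it realises
-- the contraction of x.
module _ {k m : ℕ} (w : Family k m) (x : Fin k) (q : Fin m) (wxq : w x q ≡ true) where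

  private
    c : Vector Bool m
    c = w x
    w′ : Family k m
    w′ j = pivot c q (w j)

    pivoted-zero : ∀ Z → IsZero (linComb Z w′) → linComb Z w ≗ linComb Z w q · c
    pivoted-zero Z Zw′≡0 i = xor≡false⇒≡ _ _ (trans (sym (linComb-pivot c q Z w i)) (Zw′≡0 i))

  LinIndep-pivot⁺ : (I : Vector Bool k) → I x ≡ false → LinIndep w (insert x I) → LinIndep w′ I
  LinIndep-pivot⁺ I Ix indep Z Z⊑I nonempty Zw′≡0 with linComb Z w q in Zwq
  ... | false = indep Z (λ j Zj → cong (_∨ unitVec x j) (Z⊑I j Zj)) nonempty
                  (λ i → trans (pivoted-zero Z Zw′≡0 i) (cong (_∧ c i) Zwq))
  ... | true = indep (Z ⊕ unitVec x) Z+x⊑I+x (x , Z+x-x) Z+xw≡0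
    where
    Zw≗c : linComb Z w ≗ c
    Zw≗c i = trans (pivoted-zero Z Zw′≡0 i) (cong (_∧ c i) Zwq)
    Zx : Z x ≡ false
    Zx = ≢true⇒≡false (λ Zx → true≢false (trans (sym (Z⊑I x Zx)) Ix))
    Z+x-x : Z x xor unitVec x x ≡ true
    Z+x-x rewrite Zx = unitVec-same x
    Z+x⊑I+x : (Z ⊕ unitVec x) ⊑ insert x I
    Z+x⊑I+x j e with xor≡true⇒⊎ {Z j} e
    ... | inj₁ Zj = cong (_∨ unitVec x j) (Z⊑I j Zj)
    ... | inj₂ xj = trans (cong (I j ∨_) xj) (∨-zeroʳ (I j))
    Z+xw≡0 : IsZero (linComb (Z ⊕ unitVec x) w)
    Z+xw≡0 i = trans (linComb-xor Z (unitVec x) w i)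
                     (trans (cong₂ _xor_ (Zw≗c i) (linComb-unitVec x w i)) (xor-same (c i)))

  LinIndep-pivot⁻ : (I : Vector Bool k) → LinIndep w′ I → LinIndep w (insert x I)
  LinIndep-pivot⁻ I indep Z Z⊑I+x nonempty Zw≡0 with Z x in Zx
  ... | false = indep Z Z⊑I nonempty
                  (λ i → trans (linComb-pivot c q Z w i) (cong₂ (λ a b → a xor (b ∧ c i)) (Zw≡0 i) (Zw≡0 q)))
    where
    Z⊑I : Z ⊑ I
    Z⊑I j Zj = ⊑-insert-other {I = I} Z⊑I+x j Zj (λ { refl → true≢false (trans (sym Zj) Zx) })
  ... | true with Finₚ.any? (λ j → delete x Z j Boolₚ.≟ true)
  ...   | yes nonempty′ = indep (delete x Z) Y⊑I nonempty′ Yw′≡0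
    where
    Y⊑I : delete x Z ⊑ I
    Y⊑I j e = ⊑-insert-other {I = I} Z⊑I+x j (proj₁ (delete-true Z e)) (proj₂ (delete-true Z e))
    Yw≗c : linComb (delete x Z) w ≗ c
    Yw≗c = linComb-delete-zero x Z w Zx Zw≡0
    Yw′≡0 : IsZero (linComb (delete x Z) w′)
    Yw′≡0 i = trans (linComb-pivot c q (delete x Z) w i)
                    (trans (cong₂ (λ a b → a xor (b ∧ c i)) (Yw≗c i) (trans (Yw≗c q) wxq)) (xor-same (c i)))
  ...   | no empty =
    true≢false (trans (sym wxq) (trans (sym (linComb-delete-zero x Z w Zx Zw≡0 q)) (linComb-zero (delete x Z) w Y≡0 q)))
    where
    Y≡0 : IsZero (delete x Z)
    Y≡0 j = ≢true⇒≡false (λ e → empty (j , e))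

  LinIndep-pivot : (I : Vector Bool k) → I x ≡ false → LinIndep w (insert x I) ⇔ LinIndep w′ I
  LinIndep-pivot I Ix = mk⇔ (LinIndep-pivot⁺ I Ix) (LinIndep-pivot⁻ I)

removeAt-zero : {m : ℕ} (v : Vector Bool (suc m)) (q : Fin (suc m)) → IsZero (removeAt v q) →
  v ≗ v q · unitVec q
removeAt-zero v q v′≡0 i with q ≟ i
... | yes refl = sym (∧-identityʳ (v q))
... | no q≢i =
  trans (subst (λ i → v i ≡ false) (Finₚ.punchIn-punchOut q≢i) (v′≡0 (punchOut q≢i))) (sym (∧-zeroʳ (v q)))

LinIndep-removeAt : {k m : ℕ} (w : Family k (suc m)) (q : Fin (suc m)) → ¬ InSpan w (unitVec q) →
  (I : Vector Bool k) → LinIndep w I ⇔ LinIndep (λ j → removeAt (w j) q) I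
LinIndep-removeAt w q notInSpan I = mk⇔ to from
  where
  to : LinIndep w I → LinIndep (λ j → removeAt (w j) q) I
  to indep Z Z⊑I nonempty Zw′≡0 with linComb Z w q in Zwq
  ... | false = indep Z Z⊑I nonempty (λ i → trans (removeAt-zero (linComb Z w) q Zw′≡0 i) (cong (_∧ unitVec q i) Zwq))
  ... | true = notInSpan (Z , λ i → trans (removeAt-zero (linComb Z w) q Zw′≡0 i) (cong (_∧ unitVec q i) Zwq))
  from : LinIndep (λ j → removeAt (w j) q) I → LinIndep w I
  from indep Z Z⊑I nonempty Zw≡0 = indep Z Z⊑I nonempty (λ i → Zw≡0 (punchIn q i))

LinIndep-insertAt : {k m : ℕ} (w : Family k m) (p : Fin (suc m)) (I : Vector Bool k) →
  LinIndep w I ⇔ LinIndep (λ j → insertAt (w j) p false) I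
LinIndep-insertAt w p I =
  ⇔.trans (LinIndep-congʳ I (λ j i → sym (VFₚ.insertAt-punchIn (w j) p false i)))
          (⇔.sym (LinIndep-removeAt padded p notInSpan I))
  where
  padded : Family _ _
  padded j = insertAt (w j) p false
  notInSpan : ¬ InSpan padded (unitVec p)
  notInSpan (Z , Z≗p) = true≢false (trans (sym (trans (Z≗p p) (unitVec-same p))) (xorSum-zero _ zeroRow))
    where
    zeroRow : ∀ j → Z j ∧ padded j p ≡ false
    zeroRow j = trans (cong (Z j ∧_) (VFₚ.insertAt-lookup (w j) p false)) (∧-zeroʳ (Z j))

lookup-image : {k n : ℕ} (h : Fin k → Fin n) (I : S.Subset k) (j : Fin n) →
  Vec.lookup (image h I) j ≡ BoolList.any (λ x → Vec.lookup I x ∧ unitVec (h x) j) (List.allFin k)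
lookup-image h I j = Vecₚ.lookup∘tabulate _ j

image-true : {k n : ℕ} (h : Fin k → Fin n) (I : S.Subset k) {j : Fin n} →
  Vec.lookup (image h I) j ≡ true → ∃ λ x → Vec.lookup I x ≡ true × h x ≡ j
image-true h I {j} e
  with tabulate⁻ (any⁻ _ (List.allFin _) (Equivalence.from Boolₚ.T-≡ (trans (sym (lookup-image h I j)) e)))
... | x , Tx with Equivalence.to Boolₚ.T-∧ Tx
...   | TIx , Thx = x , Equivalence.to Boolₚ.T-≡ TIx , unitVec-true (Equivalence.to Boolₚ.T-≡ Thx)

image-intro : {k n : ℕ} (h : Fin k → Fin n) (I : S.Subset k) {x : Fin k} →
  Vec.lookup I x ≡ true → Vec.lookup (image h I) (h x) ≡ true
image-intro h I {x} Ix = trans (lookup-image h I (h x)) (Equivalence.to Boolₚ.T-≡ (any⁺ _ (tabulate⁺ x Tx)))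
  where
  Tx : T (Vec.lookup I x ∧ unitVec (h x) (h x))
  Tx = Equivalence.from Boolₚ.T-≡ (cong₂ _∧_ Ix (unitVec-same (h x)))

image-injective : {k n : ℕ} {h : Fin k → Fin n} → Injective _≡_ _≡_ h → (I : S.Subset k) (x : Fin k) →
  Vec.lookup (image h I) (h x) ≡ Vec.lookup I x
image-injective {h = h} h-inj I x with Vec.lookup I x in Ix
... | true = image-intro h I Ix
... | false with Vec.lookup (image h I) (h x) in hIx
...   | false = refl
...   | true with image-true h I hIx
...     | y , Iy , hy≡hx =
  ⊥-elim (true≢false (trans (sym Iy) (subst (λ z → Vec.lookup I z ≡ false) (h-inj (sym hy≡hx)) Ix)))

linComb-reindex : {k n m : ℕ} (h : Fin k → Fin n) → Injective _≡_ _≡_ h → (w : Family n m)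
  (Z : Vector Bool n) → (∀ j → Z j ≡ true → ∃ λ x → h x ≡ j) →
  linComb Z w ≗ linComb (λ x → Z (h x)) (λ x → w (h x))
linComb-reindex {zero} h _ w Z inImage = linComb-zero Z w (λ j → ≢true⇒≡false (noPreimage j))
  where
  noPreimage : ∀ j → ¬ Z j ≡ true
  noPreimage j Zj with inImage j Zj
  ... | () , _
linComb-reindex {suc k} h h-inj w Z inImage i = begin
  linComb Z w i                                          ≡⟨ linComb-delete (h F.zero) Z w i ⟩
  linComb Z₀ w i xor head                                ≡⟨ cong (_xor head) rest ⟩
  linComb (λ x → Z (h₊ x)) (λ x → w (h₊ x)) i xor head   ≡⟨ xor-comm _ head ⟩
  linComb (λ x → Z (h x)) (λ x → w (h x)) i              ∎
  where
  open ≡-Reasoning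
  head : Bool
  head = Z (h F.zero) ∧ w (h F.zero) i
  Z₀ : Vector Bool _
  Z₀ = delete (h F.zero) Z
  h₊ : Fin k → Fin _
  h₊ x = h (F.suc x)
  inImage₊ : ∀ j → Z₀ j ≡ true → ∃ λ x → h₊ x ≡ j
  inImage₊ j e with delete-true Z e
  ... | Zj , h₀≢j with inImage j Zj
  ...   | F.zero , h₀≡j = ⊥-elim (h₀≢j h₀≡j)
  ...   | F.suc x , hx≡j = x , hx≡j
  rest : linComb Z₀ w i ≡ linComb (λ x → Z (h₊ x)) (λ x → w (h₊ x)) i
  rest = trans (linComb-reindex h₊ (λ e → Finₚ.suc-injective (h-inj e)) w Z₀ inImage₊ i)
               (linComb-cong (λ x → w (h₊ x)) (λ x → delete-other Z (λ e → 0≢suc (h-inj e))) i)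
    where
    0≢suc : {x : Fin k} → F.zero ≢ F.suc x
    0≢suc ()

LinIndep-image : {k n m : ℕ} {h : Fin k → Fin n} → Injective _≡_ _≡_ h → (w : Family n m) (I : S.Subset k) →
  LinIndep w (Vec.lookup (image h I)) ⇔ LinIndep (λ x → w (h x)) (Vec.lookup I)
LinIndep-image {h = h} h-inj w I = mk⇔ to from
  where
  to : LinIndep w (Vec.lookup (image h I)) → LinIndep (λ x → w (h x)) (Vec.lookup I)
  to indep Z′ Z′⊑I (x , Z′x) Z′w≡0 = indep Z Z⊑hI (h x , trans (Zh x) Z′x) Zw≡0
    where
    Z : Vector Bool _
    Z = Vec.lookup (image h (Vec.tabulate Z′))
    Zh : ∀ y → Z (h y) ≡ Z′ y
    Zh y = trans (image-injective h-inj (Vec.tabulate Z′) y) (Vecₚ.lookup∘tabulate Z′ y)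
    Z⊑hI : Z ⊑ Vec.lookup (image h I)
    Z⊑hI j Zj with image-true h (Vec.tabulate Z′) Zj
    ... | y , Z′y , refl = image-intro h I (Z′⊑I y (trans (sym (Vecₚ.lookup∘tabulate Z′ y)) Z′y))
    inImage : ∀ j → Z j ≡ true → ∃ λ y → h y ≡ j
    inImage j Zj = let y , _ , hy≡j = image-true h (Vec.tabulate Z′) Zj in y , hy≡j
    Zw≡0 : IsZero (linComb Z w)
    Zw≡0 i = trans (linComb-reindex h h-inj w Z inImage i) (trans (linComb-cong (λ y → w (h y)) Zh i) (Z′w≡0 i))
  from : LinIndep (λ x → w (h x)) (Vec.lookup I) → LinIndep w (Vec.lookup (image h I))
  from indep Z Z⊑hI (j , Zj) Zw≡0 with image-true h I (Z⊑hI j Zj)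
  ... | x , _ , refl =
    indep (λ y → Z (h y)) (λ y Zhy → trans (sym (image-injective h-inj I y)) (Z⊑hI (h y) Zhy)) (x , Zj)
          (λ i → trans (sym (linComb-reindex h h-inj w Z inImage i)) (Zw≡0 i))
    where
    inImage : ∀ j → Z j ≡ true → ∃ λ y → h y ≡ j
    inImage j Zj = let y , _ , hy≡j = image-true h I (Z⊑hI j Zj) in y , hy≡j

-- Vectors conforming to the template

pattern rowx₁ = F.zero
pattern rowx₂ = F.suc F.zero
pattern rowR a = F.suc (F.suc a)

pattern xslot = F.zero
pattern Rslot a = F.suc a

AtMost2 : {n : ℕ} → Vector Bool n → Set
AtMost2 g = ∀ {a b c} → a ≢ b → a ≢ c → b ≢ c → g a ≡ true → g b ≡ true → g c ≡ true → ⊥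

slots : {t : ℕ} → Vector Bool (2 + t) → Vector Bool (suc t)
slots v xslot = v rowx₁ ∨ v rowx₂
slots v (Rslot a) = v (rowR a)

Conforming : {t : ℕ} → Vector Bool (2 + t) → Set
Conforming v = AtMost2 (slots v)

AtMost2-pullback : {a b : ℕ} {g : Vector Bool b} {g′ : Vector Bool a} (φ : Fin a → Fin b) → AtMost2 g →
  (∀ s → g′ s ≡ true → g (φ s) ≡ true) → (∀ {s s′} → g′ s ≡ true → g′ s′ ≡ true → φ s ≡ φ s′ → s ≡ s′) →
  AtMost2 g′
AtMost2-pullback φ atMost2 maps inj a≢b a≢c b≢c ga gb gc =
  atMost2 (λ e → a≢b (inj ga gb e)) (λ e → a≢c (inj ga gc e)) (λ e → b≢c (inj gb gc e))
          (maps _ ga) (maps _ gb) (maps _ gc)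

AtMost2-⊑ : {n : ℕ} {g g′ : Vector Bool n} → g′ ⊑ g → AtMost2 g → AtMost2 g′
AtMost2-⊑ g′⊑g atMost2 = AtMost2-pullback (λ s → s) atMost2 g′⊑g (λ _ _ e → e)

AtMost2-one-besides : {n : ℕ} {g : Vector Bool n} {p a b : Fin n} → AtMost2 g → g p ≡ true →
  a ≢ p → b ≢ p → g a ≡ true → g b ≡ true → a ≡ b
AtMost2-one-besides {a = a} {b} atMost2 gp a≢p b≢p ga gb with a ≟ b
... | yes a≡b = a≡b
... | no a≢b = ⊥-elim (atMost2 a≢b a≢p b≢p ga gb gp)

AtMost2-merge : {n : ℕ} {f g h : Vector Bool n} {p : Fin n} → AtMost2 f → AtMost2 g →
  f p ≡ true → g p ≡ true → (∀ s → h s ≡ true → s ≢ p × (f s ≡ true ⊎ g s ≡ true)) → AtMost2 h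
AtMost2-merge af ag fp gp inside {a} {b} {c} a≢b a≢c b≢c ha hb hc
  with inside a ha | inside b hb | inside c hc
... | a≢p , inj₁ fa | b≢p , inj₁ fb | _ = a≢b (AtMost2-one-besides af fp a≢p b≢p fa fb)
... | a≢p , inj₂ ga | b≢p , inj₂ gb | _ = a≢b (AtMost2-one-besides ag gp a≢p b≢p ga gb)
... | a≢p , inj₁ fa | _ , inj₂ _ | c≢p , inj₁ fc = a≢c (AtMost2-one-besides af fp a≢p c≢p fa fc)
... | a≢p , inj₂ ga | _ , inj₁ _ | c≢p , inj₂ gc = a≢c (AtMost2-one-besides ag gp a≢p c≢p ga gc)
... | _ , inj₁ _ | b≢p , inj₂ gb | c≢p , inj₂ gc = b≢c (AtMost2-one-besides ag gp b≢p c≢p gb gc)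
... | _ , inj₂ _ | b≢p , inj₁ fb | c≢p , inj₁ fc = b≢c (AtMost2-one-besides af fp b≢p c≢p fb fc)

≗⇒slots-⊑ : {t : ℕ} {v v′ : Vector Bool (2 + t)} → v ≗ v′ → slots v ⊑ slots v′
≗⇒slots-⊑ v≗v′ xslot e = trans (sym (cong₂ _∨_ (v≗v′ rowx₁) (v≗v′ rowx₂))) e
≗⇒slots-⊑ v≗v′ (Rslot a) e = trans (sym (v≗v′ (rowR a))) e

pivot-inactive : {m : ℕ} (c : Vector Bool m) (q : Fin m) (v : Vector Bool m) → v q ≡ false → pivot c q v ≗ v
pivot-inactive c q v vq i rewrite vq = xor-identityʳ (v i)

pivot-active : {m : ℕ} (c : Vector Bool m) (q : Fin m) (v : Vector Bool m) → v q ≡ true → pivot c q v ≗ v ⊕ c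
pivot-active c q v vq i rewrite vq = refl

PivotPreservesConforming : {t : ℕ} → Vector Bool (2 + t) → Fin (2 + t) → Set
PivotPreservesConforming c q = ∀ v → Conforming v → Conforming (pivot c q v)

-- The slot of the pivot row cancels in v ⊕ c, and each of v, c has at most one other slot.
pivot-at-R : {t : ℕ} (c : Vector Bool (2 + t)) → Conforming c → (a : Fin t) → c (rowR a) ≡ true →
  PivotPreservesConforming c (rowR a)
pivot-at-R c conf a ca v vconf with v (rowR a) Boolₚ.≟ true
... | no va = AtMost2-⊑ (≗⇒slots-⊑ (pivot-inactive c _ v (≢true⇒≡false va))) vconf
... | yes va = AtMost2-⊑ (≗⇒slots-⊑ (pivot-active c _ v va)) (AtMost2-merge vconf conf va ca inside)
  where
  inside : ∀ s → slots (v ⊕ c) s ≡ true → s ≢ Rslot a × (slots v s ≡ true ⊎ slots c s ≡ true)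
  inside xslot e = (λ ()) , xor-∨-xor≡true⇒ (v rowx₁) (v rowx₂) (c rowx₁) (c rowx₂) e
  inside (Rslot b) e = (λ { refl → true≢false (trans (sym e) (cong₂ _xor_ va ca)) }) , xor≡true⇒⊎ e

pivot-at-x : {t : ℕ} (c : Vector Bool (2 + t)) → (∀ a → c (rowR a) ≡ false) → (q : Fin (2 + t)) →
  (∀ v → v q ≡ true → slots v xslot ≡ true) → PivotPreservesConforming c q
pivot-at-x c noR q inXslot v vconf with v q Boolₚ.≟ true
... | no vq = AtMost2-⊑ (≗⇒slots-⊑ (pivot-inactive c q v (≢true⇒≡false vq))) vconf
... | yes vq = AtMost2-⊑ (λ s e → sub s (≗⇒slots-⊑ (pivot-active c q v vq) s e)) vconf
  where
  sub : slots (v ⊕ c) ⊑ slots v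
  sub xslot _ = inXslot v vq
  sub (Rslot b) e = trans (sym (trans (cong (v (rowR b) xor_) (noR b)) (xor-identityʳ _))) e

x-pivot : {t : ℕ} (c : Vector Bool (2 + t)) → (∀ a → c (rowR a) ≡ false) → NonEmpty c →
  ∃ λ q → c q ≡ true × PivotPreservesConforming c q
x-pivot c noR (i , ci) with c rowx₁ in cx₁ | i | ci
... | true | _ | _ = rowx₁ , cx₁ , pivot-at-x c noR rowx₁ (λ v vx₁ → cong (_∨ v rowx₂) vx₁)
... | false | rowx₁ | cx₁′ = ⊥-elim (true≢false (trans (sym cx₁′) cx₁))
... | false | rowx₂ | cx₂ =
  rowx₂ , cx₂ , pivot-at-x c noR rowx₂ (λ v vx₂ → trans (cong (v rowx₁ ∨_) vx₂) (∨-zeroʳ _))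
... | false | rowR a | ca = ⊥-elim (true≢false (trans (sym ca) (noR a)))

conforming-pivot : {t : ℕ} (c : Vector Bool (2 + t)) → Conforming c → NonEmpty c →
  ∃ λ q → c q ≡ true × PivotPreservesConforming c q
conforming-pivot c conf nonzero with Finₚ.any? (λ a → c (rowR a) Boolₚ.≟ true)
... | yes (a , ca) = rowR a , ca , pivot-at-R c conf a ca
... | no noR = x-pivot c (λ a → ≢true⇒≡false (λ ca → noR (a , ca))) nonzero

suc≢⇒≢ : {n : ℕ} {a b : Fin n} → F.suc a ≢ F.suc b → a ≢ b
suc≢⇒≢ sa≢sb a≡b = sa≢sb (cong F.suc a≡b)

count : {n : ℕ} → Vector Bool n → ℕ
count f = VF.foldr _+_ 0 (λ i → b2n (f i))

count-tail : {n : ℕ} (f : Vector Bool (suc n)) → count (VF.tail f) ≤ count f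
count-tail f = ℕₚ.m≤n+m (count (VF.tail f)) (b2n (f F.zero))

1≤count : {n : ℕ} (f : Vector Bool n) {a : Fin n} → f a ≡ true → 1 ≤ count f
1≤count f {F.zero} fa rewrite fa = s≤s z≤n
1≤count f {F.suc a} fa = ℕₚ.≤-trans (1≤count (VF.tail f) fa) (count-tail f)

2≤count : {n : ℕ} (f : Vector Bool n) {a b : Fin n} → a ≢ b → f a ≡ true → f b ≡ true → 2 ≤ count f
2≤count f {F.zero} {F.zero} a≢b _ _ = ⊥-elim (a≢b refl)
2≤count f {F.zero} {F.suc b} _ fa fb rewrite fa = s≤s (1≤count (VF.tail f) fb)
2≤count f {F.suc a} {F.zero} _ fa fb rewrite fb = s≤s (1≤count (VF.tail f) fa)
2≤count f {F.suc a} {F.suc b} a≢b fa fb =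
  ℕₚ.≤-trans (2≤count (VF.tail f) (suc≢⇒≢ a≢b) fa fb) (count-tail f)

3≤count : {n : ℕ} (f : Vector Bool n) {a b c : Fin n} → a ≢ b → a ≢ c → b ≢ c →
  f a ≡ true → f b ≡ true → f c ≡ true → 3 ≤ count f
3≤count f {F.zero} {F.zero} a≢b _ _ _ _ _ = ⊥-elim (a≢b refl)
3≤count f {F.zero} {F.suc b} {F.zero} _ a≢c _ _ _ _ = ⊥-elim (a≢c refl)
3≤count f {F.suc a} {F.zero} {F.zero} _ _ b≢c _ _ _ = ⊥-elim (b≢c refl)
3≤count f {F.zero} {F.suc b} {F.suc c} _ _ b≢c fa fb fc rewrite fa =
  s≤s (2≤count (VF.tail f) (suc≢⇒≢ b≢c) fb fc)
3≤count f {F.suc a} {F.zero} {F.suc c} _ a≢c _ fa fb fc rewrite fb =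
  s≤s (2≤count (VF.tail f) (suc≢⇒≢ a≢c) fa fc)
3≤count f {F.suc a} {F.suc b} {F.zero} a≢b _ _ fa fb fc rewrite fc =
  s≤s (2≤count (VF.tail f) (suc≢⇒≢ a≢b) fa fb)
3≤count f {F.suc a} {F.suc b} {F.suc c} a≢b a≢c b≢c fa fb fc =
  ℕₚ.≤-trans (3≤count (VF.tail f) (suc≢⇒≢ a≢b) (suc≢⇒≢ a≢c) (suc≢⇒≢ b≢c) fa fb fc)
             (count-tail f)

nnzR≡count : {t n : ℕ} (A : BinMatrix (2 + t) n) (c : Fin n) → nnzR A c ≡ count (λ a → A (rowR a) c)
nnzR≡count A c = foldr-map-tabulate _+_ 0 (λ a → b2n (A (2 ↑ʳ a) c)) (λ a → a)

ConformingColumn⇒Conforming : {t n : ℕ} (A : BinMatrix (2 + t) n) (c : Fin n) → ConformingColumn A c →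
  Conforming (columns A c)
ConformingColumn⇒Conforming A c (inj₁ (x₁≡0 , x₂≡0 , atMost2))
  = threeInR
  where
  noX : slots (columns A c) xslot ≢ true
  noX e = true≢false (trans (sym e) (cong₂ _∨_ x₁≡0 x₂≡0))
  threeInR : Conforming (columns A c)
  threeInR {xslot} _ _ _ ga _ _ = noX ga
  threeInR {Rslot _} {xslot} _ _ _ _ gb _ = noX gb
  threeInR {Rslot _} {Rslot _} {xslot} _ _ _ _ _ gc = noX gc
  threeInR {Rslot i} {Rslot j} {Rslot k} i≢j i≢k j≢k gi gj gk =
    ℕₚ.<⇒≱ (s≤s (s≤s (s≤s z≤n)))
      (ℕₚ.≤-trans (3≤count (λ a → A (rowR a) c) (suc≢⇒≢ i≢j) (suc≢⇒≢ i≢k) (suc≢⇒≢ j≢k) gi gj gk)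
                  (subst (_≤ 2) (nnzR≡count A c) atMost2))
ConformingColumn⇒Conforming A c (inj₂ (_ , atMost1)) = twoInR
  where
  noTwo : {a b : Fin _} → Rslot a ≢ Rslot b → A (rowR a) c ≡ true → A (rowR b) c ≡ true → ⊥
  noTwo a≢b ga gb = ℕₚ.<⇒≱ (s≤s (s≤s z≤n))
    (ℕₚ.≤-trans (2≤count (λ a → A (rowR a) c) (suc≢⇒≢ a≢b) ga gb) (subst (_≤ 1) (nnzR≡count A c) atMost1))
  twoInR : Conforming (columns A c)
  twoInR {xslot} {xslot} a≢b _ _ _ _ _ = a≢b refl
  twoInR {xslot} {Rslot _} {xslot} _ a≢c _ _ _ _ = a≢c refl
  twoInR {Rslot _} {xslot} {xslot} _ _ b≢c _ _ _ = b≢c refl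
  twoInR {xslot} {Rslot _} {Rslot _} _ _ b≢c _ gb gc = noTwo b≢c gb gc
  twoInR {Rslot _} {xslot} {Rslot _} _ a≢c _ ga _ gc = noTwo a≢c ga gc
  twoInR {Rslot _} {Rslot _} a≢b _ _ ga gb _ = noTwo a≢b ga gb

Conforming-removeAt : {t : ℕ} (v : Vector Bool (2 + suc t)) (q : Fin (2 + suc t)) → Conforming v →
  Conforming (removeAt v q)
Conforming-removeAt v (rowR a) conf =
  AtMost2-pullback (punchIn (Rslot a)) conf (λ { xslot e → e ; (Rslot b) e → e })
                   (λ _ _ → Finₚ.punchIn-injective (Rslot a) _ _)
Conforming-removeAt v rowx₁ conf = AtMost2-pullback φ conf maps inj
  where
  φ : Fin _ → Fin _
  φ xslot = if v rowx₂ then xslot else Rslot F.zero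
  φ (Rslot b) = Rslot (F.suc b)
  maps : ∀ s → slots (removeAt v rowx₁) s ≡ true → slots v (φ s) ≡ true
  maps xslot e with v rowx₂ in vx₂
  ... | true = trans (cong (v rowx₁ ∨_) vx₂) (∨-zeroʳ (v rowx₁))
  ... | false = e
  maps (Rslot b) e = e
  inj : ∀ {s s′} → _ → _ → φ s ≡ φ s′ → s ≡ s′
  inj {xslot} {xslot} _ _ _ = refl
  inj {Rslot b} {Rslot b′} _ _ e = cong Rslot (Finₚ.suc-injective (Finₚ.suc-injective e))
  inj {xslot} {Rslot _} _ _ e with v rowx₂
  inj {xslot} {Rslot _} _ _ () | true
  inj {xslot} {Rslot _} _ _ () | false
  inj {Rslot _} {xslot} _ _ e with v rowx₂
  inj {Rslot _} {xslot} _ _ () | true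
  inj {Rslot _} {xslot} _ _ () | false
Conforming-removeAt v rowx₂ conf = AtMost2-pullback φ conf maps inj
  where
  φ : Fin _ → Fin _
  φ xslot = if v rowx₁ then xslot else Rslot F.zero
  φ (Rslot b) = Rslot (F.suc b)
  maps : ∀ s → slots (removeAt v rowx₂) s ≡ true → slots v (φ s) ≡ true
  maps xslot e with v rowx₁ in vx₁
  ... | true = cong (_∨ v rowx₂) vx₁
  ... | false = e
  maps (Rslot b) e = e
  inj : ∀ {s s′} → _ → _ → φ s ≡ φ s′ → s ≡ s′
  inj {xslot} {xslot} _ _ _ = refl
  inj {Rslot b} {Rslot b′} _ _ e = cong Rslot (Finₚ.suc-injective (Finₚ.suc-injective e))
  inj {xslot} {Rslot _} _ _ e with v rowx₁
  inj {xslot} {Rslot _} _ _ () | true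
  inj {xslot} {Rslot _} _ _ () | false
  inj {Rslot _} {xslot} _ _ e with v rowx₁
  inj {Rslot _} {xslot} _ _ () | true
  inj {Rslot _} {xslot} _ _ () | false

padRow : {t : ℕ} → Vector Bool (2 + t) → Vector Bool (2 + suc t)
padRow v = insertAt v (rowR F.zero) false

Conforming-padRow : {t : ℕ} (v : Vector Bool (2 + t)) → Conforming v → Conforming (padRow v)
Conforming-padRow v conf = AtMost2-pullback φ conf maps inj
  where
  φ : Fin _ → Fin _
  φ xslot = xslot
  φ (Rslot F.zero) = xslot
  φ (Rslot (F.suc b)) = Rslot b
  maps : ∀ s → slots (padRow v) s ≡ true → slots v (φ s) ≡ true
  maps xslot e = e
  maps (Rslot (F.suc b)) e = e
  inj : ∀ {s s′} → slots (padRow v) s ≡ true → slots (padRow v) s′ ≡ true → φ s ≡ φ s′ → s ≡ s′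
  inj {xslot} {xslot} _ _ _ = refl
  inj {Rslot (F.suc b)} {Rslot (F.suc b′)} _ _ e = cong (λ b → Rslot (F.suc b)) (Finₚ.suc-injective e)
  inj {xslot} {Rslot (F.suc _)} _ _ ()
  inj {Rslot (F.suc _)} {xslot} _ _ ()

padRows : {t s : ℕ} → t ≤′ s → Vector Bool (2 + t) → Vector Bool (2 + s)
padRows ≤′-refl v = v
padRows (≤′-step t≤′s) v = padRow (padRows t≤′s v)

Conforming-padRows : {t s : ℕ} (t≤′s : t ≤′ s) (v : Vector Bool (2 + t)) → Conforming v →
  Conforming (padRows t≤′s v)
Conforming-padRows ≤′-refl v conf = conf
Conforming-padRows (≤′-step t≤′s) v conf = Conforming-padRow _ (Conforming-padRows t≤′s v conf)

LinIndep-padRows : {k t s : ℕ} (t≤′s : t ≤′ s) (w : Family k (2 + t)) (I : Vector Bool k) →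
  LinIndep w I ⇔ LinIndep (λ j → padRows t≤′s (w j)) I
LinIndep-padRows ≤′-refl w I = ⇔.refl
LinIndep-padRows (≤′-step t≤′s) w I =
  ⇔.trans (LinIndep-padRows t≤′s w I) (LinIndep-insertAt (λ j → padRows t≤′s (w j)) (rowR F.zero) I)

-- Contraction of an independent set

module _ {n : ℕ} (P : Vector Bool n → Set) (P-≗ : ∀ {S S′} → S ≗ S′ → P S → P S′)
         (P-∅ : P (λ _ → false)) (P-insert : ∀ S x → S x ≡ false → P S → P (insert x S)) where

  private
    _∈ᵇ_ : Fin n → List.List (Fin n) → Bool
    j ∈ᵇ l = BoolList.any (unitVec j) l

    _∩ᵇ_ : Vector Bool n → List.List (Fin n) → Vector Bool n
    (S ∩ᵇ l) j = S j ∧ (j ∈ᵇ l)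

    P-∩ᵇ : ∀ S l → P (S ∩ᵇ l)
    P-∩ᵇ S List.[] = P-≗ (λ j → sym (∧-zeroʳ (S j))) P-∅
    P-∩ᵇ S (x List.∷ l) with S x in Sx | x ∈ᵇ l in x∈l
    ... | false | _ = P-≗ unchanged (P-∩ᵇ S l)
      where
      unchanged : S ∩ᵇ l ≗ S ∩ᵇ (x List.∷ l)
      unchanged j with j ≟ x
      ... | yes refl rewrite Sx = refl
      ... | no _ = refl
    ... | true | true = P-≗ unchanged (P-∩ᵇ S l)
      where
      unchanged : S ∩ᵇ l ≗ S ∩ᵇ (x List.∷ l)
      unchanged j with j ≟ x
      ... | yes refl rewrite Sx | x∈l = refl
      ... | no _ = refl
    ... | true | false = P-≗ grown (P-insert (S ∩ᵇ l) x x∉S∩l (P-∩ᵇ S l))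
      where
      x∉S∩l : (S ∩ᵇ l) x ≡ false
      x∉S∩l = trans (cong (S x ∧_) x∈l) (∧-zeroʳ (S x))
      grown : insert x (S ∩ᵇ l) ≗ S ∩ᵇ (x List.∷ l)
      grown j with j ≟ x
      ... | yes refl rewrite Sx | unitVec-same j = ∨-zeroʳ _
      ... | no j≢x rewrite unitVec-other (λ x≡j → j≢x (sym x≡j)) = ∨-identityʳ _

  subset-induction : ∀ S → P S
  subset-induction S = P-≗ everything (P-∩ᵇ S (List.allFin n))
    where
    everything : S ∩ᵇ List.allFin n ≗ S
    everything j = trans (cong (S j ∧_) j∈allFin) (∧-identityʳ (S j))
      where
      j∈allFin : j ∈ᵇ List.allFin n ≡ true
      j∈allFin = Equivalence.to Boolₚ.T-≡ (any⁺ _ (tabulate⁺ j (Equivalence.from Boolₚ.T-≡ (unitVec-same j))))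

Disjoint : {n : ℕ} → Vector Bool n → Vector Bool n → Set
Disjoint Y C = ∀ j → Y j ≡ true → C j ≡ false

Contracts : {k m : ℕ} → Family k m → Vector Bool k → Family k m → Set
Contracts w C w′ = ∀ Y → Disjoint Y C → LinIndep w (Y ∪ C) ⇔ LinIndep w′ Y

ConformingFamily : {k t : ℕ} → Family k (2 + t) → Set
ConformingFamily w = ∀ j → Conforming (w j)

contract-one-more : {k t : ℕ} (w w′ : Family k (2 + t)) (C : Vector Bool k) (x : Fin k) → C x ≡ false →
  LinIndep w (insert x C) → ConformingFamily w′ → Contracts w C w′ →
  ∃ λ w″ → ConformingFamily w″ × Contracts w (insert x C) w″
contract-one-more w w′ C x Cx indep conf′ contracts
  with conforming-pivot (w′ x) (conf′ x) (LinIndep-unitVec⇒nonzero w′ x indep-x)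
  where
  indep-x : LinIndep w′ (unitVec x)
  indep-x = Equivalence.to (contracts (unitVec x) (λ j x≡j → subst (λ j → C j ≡ false) (unitVec-true x≡j) Cx))
              (LinIndep-⊑ w (λ j e → trans (Boolₚ.∨-comm (C j) (unitVec x j)) e) indep)
... | q , w′xq , preserves = (λ j → pivot (w′ x) q (w′ j)) , (λ j → preserves (w′ j) (conf′ j)) , contracts″
  where
  contracts″ : Contracts w (insert x C) (λ j → pivot (w′ x) q (w′ j))
  contracts″ Y disjoint =
    ⇔.trans (LinIndep-cong w regroup)
            (⇔.trans (contracts (insert x Y) disjoint′) (LinIndep-pivot w′ x q w′xq Y Yx))
    where
    Yx : Y x ≡ false
    Yx = ≢true⇒≡false (λ Yx → true≢false (trans (sym C+x-x) (disjoint x Yx)))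
      where
      C+x-x : insert x C x ≡ true
      C+x-x = trans (cong (C x ∨_) (unitVec-same x)) (∨-zeroʳ (C x))
    disjoint′ : Disjoint (insert x Y) C
    disjoint′ j e with ∨≡true⇒⊎ {Y j} e
    ... | inj₁ Yj = Boolₚ.∨-conicalˡ (C j) (unitVec x j) (disjoint j Yj)
    ... | inj₂ x≡j = subst (λ j → C j ≡ false) (unitVec-true x≡j) Cx
    regroup : Y ∪ insert x C ≗ insert x Y ∪ C
    regroup j = trans (cong (Y j ∨_) (Boolₚ.∨-comm (C j) (unitVec x j)))
                      (sym (Boolₚ.∨-assoc (Y j) (unitVec x j) (C j)))

contraction : {k t : ℕ} (w : Family k (2 + t)) → ConformingFamily w → (B : Vector Bool k) → LinIndep w B →
  ∃ λ w′ → ConformingFamily w′ × Contracts w B w′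
contraction {k} w conf B indepB = subset-induction P P-≗ P-∅ P-insert B (λ _ e → e)
  where
  P : Vector Bool k → Set
  P C = C ⊑ B → ∃ λ w′ → ConformingFamily w′ × Contracts w C w′
  P-≗ : ∀ {C C′} → C ≗ C′ → P C → P C′
  P-≗ C≗C′ hyp C′⊑B with hyp (λ j Cj → C′⊑B j (trans (sym (C≗C′ j)) Cj))
  ... | w′ , conf′ , contracts =
    w′ , conf′ , λ Y disjoint → ⇔.trans (LinIndep-cong w (λ j → cong (Y j ∨_) (sym (C≗C′ j))))
                                          (contracts Y (λ j Yj → trans (C≗C′ j) (disjoint j Yj)))
  P-∅ : P (λ _ → false)
  P-∅ _ = w , conf , λ Y _ → LinIndep-cong w (λ j → ∨-identityʳ (Y j))
  P-insert : ∀ C x → C x ≡ false → P C → P (insert x C)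
  P-insert C x Cx hyp C+x⊑B with hyp (λ j Cj → C+x⊑B j (cong (_∨ unitVec x j) Cj))
  ... | w′ , conf′ , contracts = contract-one-more w w′ C x Cx (LinIndep-⊑ w C+x⊑B indepB) conf′ contracts

Represents : {k m : ℕ} → Matroid k → Family k m → Set
Represents N w = ∀ I → N I ⇔ LinIndep w (Vec.lookup I)

InMvΦY1⇒represented : {n : ℕ} {M : Matroid n} → InMvΦY1 M →
  Σ ℕ λ t → Σ (Family n (2 + t)) λ a → ConformingFamily a × Represents M a
InMvΦY1⇒represented (t , _ , A , conf , σ , iso) =
  t , (λ j → columns A (Bijection.to σ j)) , (λ j → ConformingColumn⇒Conforming A _ (conf _)) ,
  λ I → ⇔.trans (iso I) (⇔.trans (ColMatroid⇔LinIndep A _)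
                                  (LinIndep-image (Bijection.injective σ) (columns A) I))

minor-represented : {k n t : ℕ} {N : Matroid k} {M : Matroid n} (a : Family n (2 + t)) → ConformingFamily a →
  Represents M a → IsoToMinor N M → Σ (Family k (2 + t)) λ w → ConformingFamily w × Represents N w
minor-represented {N = N} {M} a conf rep (f , f-inj , C , f∉C , B , (B⊆C , MB , _) , iso)
  with contraction a conf (Vec.lookup B) (Equivalence.to (rep B) MB)
... | w′ , conf′ , contracts = (λ x → w′ (f x)) , (λ x → conf′ (f x)) , represents
  where
  disjoint : ∀ I → Disjoint (Vec.lookup (image f I)) (Vec.lookup B)
  disjoint I j e with image-true f I e
  ... | x , _ , refl = ≢true⇒≡false (λ Bfx → f∉C x (B⊆C (≡true⇒∈ Bfx)))
  represents : Represents N (λ x → w′ (f x))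
  represents I = begin
    N I                                                 ≈⟨ iso I ⟩
    M (image f I S.∪ B)                                 ≈⟨ rep (image f I S.∪ B) ⟩
    LinIndep a (Vec.lookup (image f I S.∪ B))           ≈⟨ LinIndep-cong a lookup-∪ ⟩
    LinIndep a (Vec.lookup (image f I) ∪ Vec.lookup B)  ≈⟨ contracts (Vec.lookup (image f I)) (disjoint I) ⟩
    LinIndep w′ (Vec.lookup (image f I))                ≈⟨ LinIndep-image f-inj w′ I ⟩
    LinIndep (λ x → w′ (f x)) (Vec.lookup I)            ∎
    where
    open ⇔-Reasoning
    lookup-∪ : Vec.lookup (image f I S.∪ B) ≗ Vec.lookup (image f I) ∪ Vec.lookup B
    lookup-∪ j = Vecₚ.lookup-zipWith _∨_ j (image f I) B

-- Deleting redundant rows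

FullRowRank : {k m : ℕ} → Family k m → Set
FullRowRank w = ∀ q → InSpan w (unitVec q)

-- A row can only be deleted while R is nonempty, since the template needs both rows x₁ and x₂.
Pruned : {k t : ℕ} → Family k (2 + t) → Set
Pruned {t = t} w = t ≡ 0 ⊎ FullRowRank w

prune : {k : ℕ} (t : ℕ) (w : Family k (2 + t)) → ConformingFamily w →
  Σ ℕ λ t′ → Σ (Family k (2 + t′)) λ w′ →
    ConformingFamily w′ × (∀ I → LinIndep w I ⇔ LinIndep w′ I) × Pruned w′
prune zero w conf = zero , w , conf , (λ _ → ⇔.refl) , inj₁ refl
prune (suc t) w conf with Finₚ.any? (λ q → ¬? (InSpan? w (unitVec q)))
... | no allInSpan = suc t , w , conf , (λ _ → ⇔.refl) ,
                     inj₂ (λ q → decidable-stable (InSpan? w (unitVec q)) (λ ∉span → allInSpan (q , ∉span)))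
... | yes (q , notInSpan) with prune t (λ j → removeAt (w j) q) (λ j → Conforming-removeAt (w j) q (conf j))
...   | t′ , w′ , conf′ , equiv , pruned =
  t′ , w′ , conf′ , (λ I → ⇔.trans (LinIndep-removeAt w q notInSpan I) (equiv I)) , pruned

pruned-rows-bound : {k t s : ℕ} (w : Family k (2 + t)) → Pruned w → (B : S.Subset k) →
  LinIndep w (Vec.lookup B) → S.∣ B ∣ ≡ 2 + s → (∀ I → LinIndep w (Vec.lookup I) → S.∣ I ∣ ≤ 2 + s) → t ≤ s
pruned-rows-bound w (inj₁ refl) _ _ _ _ = z≤n
pruned-rows-bound {t = t} w (inj₂ fullRank) B indepB ∣B∣ maximal =
  ℕₚ.≤-pred (ℕₚ.≤-pred (subst (2 + t ≤_) ∣B∣ (dimension-bound w B unitsInBasisSpan)))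
  where
  spans : ∀ x → InSpan (restrict (Vec.lookup B) w) (w x)
  spans = maximal-independent-spans w B indepB (λ I indep → subst (S.∣ I ∣ ≤_) (sym ∣B∣) (maximal I indep))
  unitsInBasisSpan : ∀ q → InSpan (restrict (Vec.lookup B) w) (unitVec q)
  unitsInBasisSpan q with fullRank q
  ... | Z , Zw≗q with InSpan-linComb (restrict (Vec.lookup B) w) w spans Z
  ...   | Y , Y≗Zw = Y , λ i → trans (Y≗Zw i) (Zw≗q i)

-- The columns of X_r

AtMost2-pair : {s : ℕ} {ρ : Vector Bool s} {a b : Fin s} → AtMost2 ρ → a ≢ b → ρ a ≡ true → ρ b ≡ true →
  ρ ≗ unitVec a ⊕ unitVec b
AtMost2-pair {a = a} {b} atMost2 a≢b ρa ρb i with a ≟ i | b ≟ i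
... | yes refl | yes refl = ⊥-elim (a≢b refl)
... | yes refl | no _ = ρa
... | no _ | yes refl = ρb
... | no a≢i | no b≢i = ≢true⇒≡false (atMost2 a≢b a≢i b≢i ρa ρb)

data Support≤2 {s : ℕ} (ρ : Vector Bool s) : Set where
  none : IsZero ρ → Support≤2 ρ
  one : ∀ a → ρ ≗ unitVec a → Support≤2 ρ
  two : ∀ a b → a F.< b → ρ ≗ unitVec a ⊕ unitVec b → Support≤2 ρ

support≤2 : {s : ℕ} (ρ : Vector Bool s) → AtMost2 ρ → Support≤2 ρ
support≤2 ρ atMost2 with Finₚ.any? (λ a → ρ a Boolₚ.≟ true)
... | no noneTrue = none (λ a → ≢true⇒≡false (λ ρa → noneTrue (a , ρa)))
... | yes (a , ρa) with Finₚ.any? (λ b → ¬? (a ≟ b) ×-dec (ρ b Boolₚ.≟ true))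
...   | no onlyA = one a onlyAt
  where
  onlyAt : ρ ≗ unitVec a
  onlyAt i with a ≟ i
  ... | yes refl = ρa
  ... | no a≢i = ≢true⇒≡false (λ ρi → onlyA (i , a≢i , ρi))
...   | yes (b , a≢b , ρb) with Finₚ.<-cmp a b
...     | tri< a<b _ _ = two a b a<b (AtMost2-pair atMost2 a≢b ρa ρb)
...     | tri≈ _ a≡b _ = ⊥-elim (a≢b a≡b)
...     | tri> _ _ b<a = two b a b<a (AtMost2-pair atMost2 (λ b≡a → a≢b (sym b≡a)) ρb ρa)

InX : {s : ℕ} → Vector Bool (2 + s) → Set
InX {s} v = Any (_≗ v) (XColumns (2 + s))

-- XColumns (2 + s) unfolds definitionally to R-units s ++ R-pairs s ++ concatMap (xBlock s) (xUnits s).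
R-units R-pairs : (s : ℕ) → List.List (Vector Bool (2 + s))
R-units s = List.map (λ a → unitVec (rowR a)) (List.allFin s)
R-pairs s = List.map (λ ab → unitVec (rowR (proj₁ ab)) ⊕ unitVec (rowR (proj₂ ab))) (ltPairs s)

xUnits : (s : ℕ) → List.List (Vector Bool (2 + s))
xUnits s = unitVec rowx₁ List.∷ unitVec rowx₂ List.∷ (unitVec rowx₁ ⊕ unitVec rowx₂) List.∷ List.[]

xBlock : (s : ℕ) → Vector Bool (2 + s) → List.List (Vector Bool (2 + s))
xBlock s u = u List.∷ List.map (λ i → u ⊕ unitVec (2 ↑ʳ i)) (List.allFin s)

unitVec-rowR : {s : ℕ} (a b : Fin s) → unitVec {2 + s} (rowR a) (rowR b) ≡ unitVec a b
unitVec-rowR a b with rowR a ≟ rowR b | a ≟ b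
... | yes _ | yes _ = refl
... | no _ | no _ = refl
... | yes e | no a≢b = ⊥-elim (a≢b (Finₚ.suc-injective (Finₚ.suc-injective e)))
... | no ne | yes refl = ⊥-elim (ne refl)

≗-by-rows : {s : ℕ} {u v : Vector Bool (2 + s)} → u rowx₁ ≡ v rowx₁ → u rowx₂ ≡ v rowx₂ →
  (∀ a → u (rowR a) ≡ v (rowR a)) → u ≗ v
≗-by-rows e₁ e₂ eR rowx₁ = e₁
≗-by-rows e₁ e₂ eR rowx₂ = e₂
≗-by-rows e₁ e₂ eR (rowR a) = eR a

R-unit∈X : {s : ℕ} (a : Fin s) {v : Vector Bool (2 + s)} → unitVec (rowR a) ≗ v → InX v
R-unit∈X a eq = ++⁺ˡ (map⁺ (tabulate⁺ a eq))

if-<-member : {s : ℕ} {P : Fin s × Fin s → Set} (a b : Fin s) → a F.< b → P (a , b) →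
  Any P (if ⌊ a <? b ⌋ then List.[ (a , b) ] else List.[])
if-<-member a b a<b p with a <? b
... | yes _ = here p
... | no a≮b = ⊥-elim (a≮b a<b)

∈-ltPairs : {s : ℕ} {P : Fin s × Fin s → Set} (a b : Fin s) → a F.< b → P (a , b) → Any P (ltPairs s)
∈-ltPairs {s} a b a<b p =
  concatMap⁺ (λ i → List.concatMap (λ j → if ⌊ i <? j ⌋ then List.[ (i , j) ] else List.[]) (List.allFin s))
    (tabulate⁺ a (concatMap⁺ (λ j → if ⌊ a <? j ⌋ then List.[ (a , j) ] else List.[])
                    (tabulate⁺ b (if-<-member a b a<b p))))

R-pair∈X : {s : ℕ} (a b : Fin s) → a F.< b → {v : Vector Bool (2 + s)} →
  unitVec (rowR a) ⊕ unitVec (rowR b) ≗ v → InX v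
R-pair∈X {s} a b a<b eq =
  ++⁺ʳ (R-units s) (++⁺ˡ (map⁺ (∈-ltPairs a b a<b eq)))

RPartAtMost1 : {s : ℕ} → Vector Bool (2 + s) → Set
RPartAtMost1 v = IsZero (λ a → v (rowR a)) ⊎ ∃ λ a → (λ b → v (rowR b)) ≗ unitVec a

x-block : {s : ℕ} (u v : Vector Bool (2 + s)) → u rowx₁ ≡ v rowx₁ → u rowx₂ ≡ v rowx₂ →
  (∀ a → u (rowR a) ≡ false) → RPartAtMost1 v → Any (_≗ v) (xBlock s u)
x-block u v e₁ e₂ uR (inj₁ vR≡0) = here (≗-by-rows e₁ e₂ (λ a → trans (uR a) (sym (vR≡0 a))))
x-block u v e₁ e₂ uR (inj₂ (a , vR≗a)) =
  there (map⁺ (tabulate⁺ a (≗-by-rows (trans (xor-identityʳ _) e₁) (trans (xor-identityʳ _) e₂)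
                                      (λ b → trans (cong₂ _xor_ (uR b) (unitVec-rowR a b)) (sym (vR≗a b))))))

x-blocks∈X : {s : ℕ} {v : Vector Bool (2 + s)} → Any (λ u → Any (_≗ v) (xBlock s u)) (xUnits s) → InX v
x-blocks∈X {s} p = ++⁺ʳ (R-units s) (++⁺ʳ (R-pairs s) (concatMap⁺ (xBlock s) p))

x-part∈X : {s : ℕ} (v : Vector Bool (2 + s)) → v rowx₁ ∨ v rowx₂ ≡ true → RPartAtMost1 v → InX v
x-part∈X v xv vR with v rowx₁ in e₁ | v rowx₂ in e₂
... | true | false =
  x-blocks∈X (here (x-block (unitVec rowx₁) v (sym e₁) (sym e₂) (λ _ → refl) vR))
... | false | true =
  x-blocks∈X (there (here (x-block (unitVec rowx₂) v (sym e₁) (sym e₂) (λ _ → refl) vR)))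
... | true | true =
  x-blocks∈X (there (there (here (x-block (unitVec rowx₁ ⊕ unitVec rowx₂) v (sym e₁) (sym e₂) (λ _ → refl) vR))))

conforming∈X : {s : ℕ} (v : Vector Bool (2 + s)) → Conforming v → NonEmpty v → InX v
conforming∈X v conf (i , vi) with support≤2 (λ a → v (rowR a)) RPart≤2
  where
  RPart≤2 : AtMost2 (λ a → v (rowR a))
  RPart≤2 = AtMost2-pullback Rslot conf (λ _ e → e) (λ _ _ → Finₚ.suc-injective)
... | none vR≡0 = x-part∈X v (xNonzero i vi) (inj₁ vR≡0)
  where
  xNonzero : ∀ i → v i ≡ true → v rowx₁ ∨ v rowx₂ ≡ true
  xNonzero rowx₁ e = cong (_∨ v rowx₂) e
  xNonzero rowx₂ e = trans (cong (v rowx₁ ∨_) e) (∨-zeroʳ _)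
  xNonzero (rowR a) e = ⊥-elim (true≢false (trans (sym e) (vR≡0 a)))
... | two a b a<b vR≗ab = R-pair∈X a b a<b (≗-by-rows (sym (proj₁ x≡0)) (sym (proj₂ x≡0)) onR)
  where
  a≢b : a ≢ b
  a≢b a≡b = Finₚ.<-irrefl a≡b a<b
  vRa : v (rowR a) ≡ true
  vRa = trans (vR≗ab a) (cong₂ _xor_ (unitVec-same a) (unitVec-other (λ b≡a → a≢b (sym b≡a))))
  vRb : v (rowR b) ≡ true
  vRb = trans (vR≗ab b) (cong₂ _xor_ (unitVec-other a≢b) (unitVec-same b))
  x≡0 : v rowx₁ ≡ false × v rowx₂ ≡ false
  x≡0 = ∨≡false⇒× (≢true⇒≡false (λ xv → conf {xslot} {Rslot a} {Rslot b} (λ ()) (λ ()) Ra≢Rb xv vRa vRb))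
    where
    Ra≢Rb : Rslot a ≢ Rslot b
    Ra≢Rb e = a≢b (Finₚ.suc-injective e)
  onR : ∀ c → (unitVec (rowR a) ⊕ unitVec (rowR b)) (rowR c) ≡ v (rowR c)
  onR c = trans (cong₂ _xor_ (unitVec-rowR a c) (unitVec-rowR b c)) (sym (vR≗ab c))
... | one a vR≗a with v rowx₁ ∨ v rowx₂ Boolₚ.≟ true
...   | yes xv = x-part∈X v xv (inj₂ (a , vR≗a))
...   | no xv = R-unit∈X a (≗-by-rows (sym (proj₁ x≡0)) (sym (proj₂ x≡0)) onR)
  where
  x≡0 : v rowx₁ ≡ false × v rowx₂ ≡ false
  x≡0 = ∨≡false⇒× (≢true⇒≡false xv)
  onR : ∀ b → unitVec (rowR a) (rowR b) ≡ v (rowR b)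
  onR b = trans (unitVec-rowR a b) (sym (vR≗a b))

module _ {k m : ℕ} {N : Matroid k} {w : Family k m} (simple : Simple N) (rep : Represents N w) where

  simple⇒nonzero : ∀ x → NonEmpty (w x)
  simple⇒nonzero x = LinIndep-unitVec⇒nonzero w x (Equivalence.to (LinIndep-cong w (lookup-⁅⁆ x)) indep)
    where
    indep : LinIndep w (Vec.lookup S.⁅ x ⁆)
    indep = Equivalence.to (rep S.⁅ x ⁆) (simple S.⁅ x ⁆ (ℕₚ.≤-trans (ℕₚ.≤-reflexive (Sₚ.∣⁅x⁆∣≡1 x)) (s≤s z≤n)))

  simple⇒distinct : ∀ x y → w x ≗ w y → x ≡ y
  simple⇒distinct x y wx≗wy with x ≟ y
  ... | yes x≡y = x≡y
  ... | no x≢y = ⊥-elim (indep (unitVec x ⊕ unitVec y) pair⊑ (x , x∈pair) pair≡0)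
    where
    pair : S.Subset k
    pair = S.⁅ x ⁆ S.∪ S.⁅ y ⁆
    indep : LinIndep w (Vec.lookup pair)
    indep = Equivalence.to (rep pair) (simple pair (ℕₚ.≤-reflexive (∣⁅x⁆∪⁅y⁆∣≡2 x≢y)))
    pair⊑ : (unitVec x ⊕ unitVec y) ⊑ Vec.lookup pair
    pair⊑ j e = trans (lookup-∪-⁅⁆ S.⁅ x ⁆ y j)
                      (trans (cong (_∨ unitVec y j) (lookup-⁅⁆ x j)) (xor≡true⇒∨≡true {unitVec x j} e))
    x∈pair : unitVec x x xor unitVec y x ≡ true
    x∈pair rewrite unitVec-same x | unitVec-other (λ y≡x → x≢y (sym y≡x)) = refl
    pair≡0 : IsZero (linComb (unitVec x ⊕ unitVec y) w)
    pair≡0 i = trans (linComb-xor (unitVec x) (unitVec y) w i)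
                     (trans (cong₂ _xor_ (linComb-unitVec x w i) (linComb-unitVec y w i))
                            (trans (cong (_xor w y i) (wx≗wy i)) (xor-same (w y i))))

columns⇒restriction : {k m n : ℕ} {N : Matroid k} (A : BinMatrix m n) {w : Family k m} → Represents N w →
  (f : Fin k → Fin n) → Injective _≡_ _≡_ f → (∀ x → columns A (f x) ≗ w x) →
  IsoToRestriction N (ColMatroid A)
columns⇒restriction {N = N} A {w} rep f f-inj f-cols = f , f-inj , λ I → begin
  N I                                               ≈⟨ rep I ⟩
  LinIndep w (Vec.lookup I)                         ≈⟨ LinIndep-congʳ (Vec.lookup I) f-cols ⟨
  LinIndep (λ x → columns A (f x)) (Vec.lookup I)   ≈⟨ LinIndep-image f-inj (columns A) I ⟨
  LinIndep (columns A) (Vec.lookup (image f I))     ≈⟨ ColMatroid⇔LinIndep A (image f I) ⟨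
  ColMatroid A (image f I)                          ∎
  where open ⇔-Reasoning

conforming⇒restriction-of-X : {k : ℕ} (s t : ℕ) {N : Matroid k} → Simple N → HasRank N (2 + s) →
  (w : Family k (2 + t)) → ConformingFamily w → Represents N w → IsoToRestriction N (X (2 + s))
conforming⇒restriction-of-X s t {N} simple ((B , NB , ∣B∣) , maximal) w conf rep with prune t w conf
... | t′ , w′ , conf′ , equiv , pruned = columns⇒restriction (XMatrix (2 + s)) rep″ f f-inj f-cols
  where
  rep′ : Represents N w′
  rep′ I = ⇔.trans (rep I) (equiv (Vec.lookup I))
  t′≤′s : t′ ≤′ s
  t′≤′s = ℕₚ.≤⇒≤′ (pruned-rows-bound w′ pruned B (Equivalence.to (rep′ B) NB) ∣B∣
                                       (λ I indep → maximal I (Equivalence.from (rep′ I) indep)))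
  w″ : Family _ (2 + s)
  w″ x = padRows t′≤′s (w′ x)
  rep″ : Represents N w″
  rep″ I = ⇔.trans (rep′ I) (LinIndep-padRows t′≤′s w′ (Vec.lookup I))
  inX : ∀ x → InX (w″ x)
  inX x = conforming∈X (w″ x) (Conforming-padRows t′≤′s (w′ x) (conf′ x)) (simple⇒nonzero simple rep″ x)
  f : Fin _ → Fin _
  f x = Any.index (inX x)
  f-cols : ∀ x → columns (XMatrix (2 + s)) (f x) ≗ w″ x
  f-cols x = lookup-index (inX x)
  f-inj : Injective _≡_ _≡_ f
  f-inj {x} {y} fx≡fy = simple⇒distinct simple rep″ x y λ i →
    trans (sym (f-cols x i)) (trans (cong (λ c → columns (XMatrix (2 + s)) c i) fx≡fy) (f-cols y i))

X₁-free : ∀ Y → X 1 Y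
X₁-free Y = Equivalence.from (ColMatroid⇔LinIndep (XMatrix 1) Y) freeColumn
  where
  freeColumn : LinIndep (columns (XMatrix 1)) (Vec.lookup Y)
  freeColumn _ _ (F.zero , Z₀) Z≡0 =
    true≢false (trans (sym (cong (λ b → (b ∧ true) xor false) Z₀)) (Z≡0 F.zero))

everything-independent : {k : ℕ} (N : Matroid k) → Simple N → k ≤ 2 → (f : Fin k → Fin 1) →
  ∀ I → N I ⇔ X 1 (image f I)
everything-independent N simple k≤2 f I = mk⇔ (λ _ → X₁-free _) (λ _ → simple I (ℕₚ.≤-trans (Sₚ.∣p∣≤n I) k≤2))

rank-one⇒restriction-of-X : {k : ℕ} (N : Matroid k) → Simple N → HasRank N 1 → IsoToRestriction N (X 1)
rank-one⇒restriction-of-X {zero} N simple _ = (λ ()) , (λ { {()} }) , everything-independent N simple z≤n (λ ())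
rank-one⇒restriction-of-X {suc zero} N simple _ =
  (λ _ → F.zero) , (λ { {F.zero} {F.zero} _ → refl }) , everything-independent N simple (s≤s z≤n) (λ _ → F.zero)
rank-one⇒restriction-of-X {suc (suc k)} N simple (_ , rank≤1) =
  ⊥-elim (ℕₚ.<⇒≱ (s≤s (s≤s z≤n)) (subst (_≤ 1) ∣pair∣ (rank≤1 pair (simple pair (ℕₚ.≤-reflexive ∣pair∣)))))
  where
  pair : S.Subset (suc (suc k))
  pair = S.⁅ F.zero ⁆ S.∪ S.⁅ F.suc F.zero ⁆
  ∣pair∣ : S.∣ pair ∣ ≡ 2
  ∣pair∣ = ∣⁅x⁆∪⁅y⁆∣≡2 {suc (suc k)} {F.zero} {F.suc F.zero} (λ ())

lemma4p6 : (r : ℕ) → 1 ≤ r →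
    {k : ℕ} (N : Matroid k) → IsMatroid N → Simple N → HasRank N r →
    (Σ ℕ λ n → Σ (Matroid n) λ M → InMvΦY1 M × IsoToMinor N M) →
    IsoToRestriction N (X r)
lemma4p6 (suc zero) _ N _ simple rank _ = rank-one⇒restriction-of-X N simple rank
lemma4p6 (suc (suc s)) _ N _ simple rank (_ , _ , inMv , minor)
  with InMvΦY1⇒represented inMv
... | t , a , conf , rep with minor-represented a conf rep minor
...   | w , conf′ , rep′ = conforming⇒restriction-of-X s t simple rank w conf′ rep′
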